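{- The set-operads $\mathcal{BWTS}$ and $\mathcal{GR}_4$ are isomorphic as operads.
   Context: $\mathcal{GR}_4$ is the quotient of the free non-symmetric set-operad on four binary generators $\prec,\succ,\circ,\odot$ by the operad congruence generated by $(x\succ y)\prec z=x\succ(y\prec z)$, $(x\circ y)\circ z=x\circ(y\circ z)$, $(x\succ y)\circ z=x\succ(y\circ z)$, $(x\prec y)\circ z=x\circ(y\succ z)$, $(x\circ y)\prec z=x\circ(y\prec z)$, $(x\odot y)\odot z=x\odot(y\odot z)$, $(x\prec y)\prec z=x\prec(y\odot z)$, $(x\odot y)\succ z=x\succ(y\succ z)$. A red and white tree of weight $n$ is a rooted tree with unordered children, each node carrying a (possibly empty) set of labels, label sets pairwise disjoint with union $\{1,\dots,n\}$, every node with empty label set having at least two children; a labelled node is white, an unlabelled node is red iff all its children are white (white otherwise). Composition $T_1\circ_x T_2$ ($T_2$ of weight $k$, $x$ a label of $T_1$ in node $z$): relabel labels $y>x$ of $T_1$ as $y+k-1$ and add $x-1$ to labels of $T_2$; (W) if the root of $T_2$ is not red, erase $x$ from $z$, add the root labels of $T_2$ to $z$ and make the root's children children of $z$; (R1) if the root of $T_2$ is red and $T_1$ is the one-node tree $\{x\}$, the result is $T_2$; (R2) if the root of $T_2$ is red and $z$ is not a leaf or has at least two labels, remove $x$ from $z$ and attach the root of $T_2$ as a child of $z$; (R3) if the root of $T_2$ is red and $z$ is a non-root leaf with sole label $x$, delete $z$ and make the children of the root of $T_2$ children of the parent of $z$; $z$ is white if it ends with no labels. Unit: one-node tree $\{1\}$.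 $\mathcal{BWTS}$ is the sub-operad generated by the four weight-2 trees: one node $\{1,2\}$; root $\{1\}$ with child $\{2\}$; root $\{2\}$ with child $\{1\}$; red empty root with leaves $\{1\},\{2\}$. -}

module Defs where

open import Data.Nat using (ℕ; zero; suc; _+_; _∸_; _≤_; _≤ᵇ_; _<ᵇ_; _≡ᵇ_)
open import Data.Bool using (Bool; true; false; if_then_else_; not; _∧_; _∨_)
open import Data.List using (List; []; _∷_; _++_; length; filter)
open import Data.List.Relation.Binary.Pointwise using (Pointwise)
open import Data.List.Relation.Binary.Permutation.Propositional using (_↭_)
open import Data.Product using (Σ; _×_)
open import Relation.Nullary using (¬_)
open import Relation.Binary.PropositionalEquality using (_≡_)

-- The free non-symmetric set-operad on four binary generators.
-- An element is a planar binary tree whose internal nodes carry one of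
-- the four operations; its arity is its number of leaves, leaves being
-- numbered 1, 2, ... from left to right.

data Op : Set where
  prec succ circ odot : Op

data FT : Set where
  leaf : FT
  node : Op → FT → FT → FT

ar : FT → ℕ
ar leaf = 1
ar (node _ l r) = ar l + ar r

-- partial composition s ∘_x t : graft t on the x-th leaf (1-indexed) of s
graft : FT → ℕ → FT → FT
graft leaf x t = if x ≡ᵇ 1 then t else leaf
graft (node o l r) x t =
  if x ≤ᵇ ar l then node o (graft l x t) r
  else node o l (graft r (x ∸ ar l) t)

bin : Op → FT → FT → FT
bin = node

data Rel : FT → FT → Set where
  r1 : Rel (bin prec (bin succ leaf leaf) leaf) (bin succ leaf (bin prec leaf leaf))
  r2 : Rel (bin circ (bin circ leaf leaf) leaf) (bin circ leaf (bin circ leaf leaf))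
  r3 : Rel (bin circ (bin succ leaf leaf) leaf) (bin succ leaf (bin circ leaf leaf))
  r4 : Rel (bin circ (bin prec leaf leaf) leaf) (bin circ leaf (bin succ leaf leaf))
  r5 : Rel (bin prec (bin circ leaf leaf) leaf) (bin circ leaf (bin prec leaf leaf))
  r6 : Rel (bin odot (bin odot leaf leaf) leaf) (bin odot leaf (bin odot leaf leaf))
  r7 : Rel (bin prec (bin prec leaf leaf) leaf) (bin prec leaf (bin odot leaf leaf))
  r8 : Rel (bin succ (bin odot leaf leaf) leaf) (bin succ leaf (bin succ leaf leaf))

data _~_ : FT → FT → Set where
  ax    : ∀ {s t} → Rel s t → s ~ t
  ~refl  : ∀ {s} → s ~ s
  ~sym   : ∀ {s t} → s ~ t → t ~ s
  ~trans : ∀ {s t u} → s ~ t → t ~ u → s ~ u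
  ~comp  : ∀ {s s' t t'} x → 1 ≤ x → x ≤ ar s → s ~ s' → t ~ t' →
           graft s x t ~ graft s' x t'

-- A tree is a node with a list of labels and a list of children; order
-- of children and of labels is irrelevant, captured by the equivalence
-- _≅_ below. Colours are computed from the shape (red iff unlabelled
-- and all children white).

data RT : Set where
  nd : List ℕ → List RT → RT

labels : RT → List ℕ
labels (nd L _) = L

children : RT → List RT
children (nd _ cs) = cs

data _≅_ : RT → RT → Set where
  nd≅ : ∀ {L L' cs ds} → L ↭ L' →
        Σ (List RT) (λ es → Pointwise _≅_ cs es × (es ↭ ds)) →
        nd L cs ≅ nd L' ds

mutual
  isRed : RT → Bool
  isRed (nd [] cs) = allWhite cs
  isRed (nd (_ ∷ _) _) = false

  allWhite : List RT → Bool
  allWhite [] = true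
  allWhite (c ∷ cs) = not (isRed c) ∧ allWhite cs

mutual
  flatten : RT → List ℕ
  flatten (nd L cs) = L ++ flattenL cs

  flattenL : List RT → List ℕ
  flattenL [] = []
  flattenL (c ∷ cs) = flatten c ++ flattenL cs

-- weight: number of labels (the labels of a weight-n tree are 1..n)
weight : RT → ℕ
weight T = length (flatten T)

mutual
  mapLab : (ℕ → ℕ) → RT → RT
  mapLab f (nd L cs) = nd (mapN f L) (mapLabL f cs)

  mapLabL : (ℕ → ℕ) → List RT → List RT
  mapLabL f [] = []
  mapLabL f (c ∷ cs) = mapLab f c ∷ mapLabL f cs

  mapN : (ℕ → ℕ) → List ℕ → List ℕ
  mapN f [] = []
  mapN f (y ∷ ys) = f y ∷ mapN f ys

elem : ℕ → List ℕ → Bool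
elem x [] = false
elem x (y ∷ ys) = (x ≡ᵇ y) ∨ elem x ys

removeN : ℕ → List ℕ → List ℕ
removeN x [] = []
removeN x (y ∷ ys) = if x ≡ᵇ y then removeN x ys else y ∷ removeN x ys

isSingleLeaf : ℕ → RT → Bool
isSingleLeaf x (nd (y ∷ []) []) = x ≡ᵇ y
isSingleLeaf x _ = false

mutual
  insW : ℕ → RT → RT → RT
  insW x S (nd L cs) =
    if elem x L then nd (removeN x L ++ labels S) (cs ++ children S)
    else nd L (insWL x S cs)

  insWL : ℕ → RT → List RT → List RT
  insWL x S [] = []
  insWL x S (c ∷ cs) = insW x S c ∷ insWL x S cs

-- rules (R2)/(R3): S has a red root
mutual
  insR : ℕ → RT → RT → RT
  insR x S (nd L cs) =
    if elem x L then nd (removeN x L) (cs ++ (S ∷ []))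
    else nd L (insRL x S cs)

  insRL : ℕ → RT → List RT → List RT
  insRL x S [] = []
  insRL x S (c ∷ cs) =
    if isSingleLeaf x c then children S ++ insRL x S cs
    else insR x S c ∷ insRL x S cs

compose : RT → ℕ → RT → RT
compose T₁ x T₂ =
  let k  = weight T₂
      T₁' = mapLab (λ y → if x <ᵇ y then y + k ∸ 1 else y) T₁
      T₂' = mapLab (λ y → y + x ∸ 1) T₂
  in if isRed T₂'
     then (if isSingleLeaf x T₁' then T₂' else insR x T₂' T₁')
     else insW x T₂' T₁'

unitT : RT
unitT = nd (1 ∷ []) []

gen₁ gen₂ gen₃ gen₄ : RT
gen₁ = nd (1 ∷ 2 ∷ []) []
gen₂ = nd (1 ∷ []) (nd (2 ∷ []) [] ∷ [])
gen₃ = nd (2 ∷ []) (nd (1 ∷ []) [] ∷ [])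
gen₄ = nd [] (nd (1 ∷ []) [] ∷ nd (2 ∷ []) [] ∷ [])

data Gen : RT → Set where
  gUnit : Gen unitT
  g₁ : Gen gen₁
  g₂ : Gen gen₂
  g₃ : Gen gen₃
  g₄ : Gen gen₄
  gComp : ∀ {T₁ T₂} x → Gen T₁ → Gen T₂ → 1 ≤ x → x ≤ weight T₁ →
          Gen (compose T₁ x T₂)

InBWTS : RT → Set
InBWTS T = Σ RT (λ T' → Gen T' × (T ≅ T'))

-- An operad isomorphism GR4 → BWTS, presented by a map on representatives
-- that is well defined and injective on classes, arity preserving,
-- onto BWTS, and compatible with unit and partial compositions.

record IsOperadIso (φ : FT → RT) : Set where
  field
    arity   : ∀ s → weight (φ s) ≡ ar s
    into    : ∀ s → InBWTS (φ s)
    onto    : ∀ T → InBWTS T → Σ FT (λ s → φ s ≅ T)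
    resp    : ∀ s t → s ~ t → φ s ≅ φ t
    injec   : ∀ s t → φ s ≅ φ t → s ~ t
    unit    : φ leaf ≅ unitT
    compat  : ∀ s t x → 1 ≤ x → x ≤ ar s →
              φ (graft s x t) ≅ compose (φ s) x (φ t)

-- The map φ reads each operation as a way of joining the images of its two operands: ∘ fuses
-- both roots, ≺ (resp. ≻) fuses the root of its left (resp. right) operand and hangs the other one
-- below it, and ⊙ hangs both below a fresh unlabelled root; a red operand hung below a root
-- dissolves into its children, and a red operand fused into a root stays a child. The eight
-- relations then hold on the nose, and compatibility with partial composition reduces to the fact
-- that inserting a tree at a label of one operand commutes with these joins. Since φ sends the four
-- operations to the four generators, its image is BWTS. For injectivity, orienting the relations
-- from left to right gives normal forms, and a normal form is recovered from its image by following
-- its smallest label: it lies either in the root, and the left operand is a leaf, or in a single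
-- child, which is the image of the left operand; the colours and the labels of the rest then
-- determine the operation.
module Submission where

open import Defs
open import Data.Nat using (ℕ; zero; suc; _+_; _∸_; _≤_; _<_; _≤ᵇ_; _<ᵇ_; _≡ᵇ_; z≤n; s≤s)
open import Data.Nat.Properties
open import Data.Bool using (Bool; true; false; if_then_else_; not; _∧_; _∨_; T)
open import Data.Bool.Properties using (∨-assoc; ∨-comm; ∧-assoc; ∧-comm; ∧-zeroʳ)
open import Data.List using (List; []; _∷_; _++_; length; map; concatMap; null)
import Data.List.Properties as List
open import Data.List.Relation.Binary.Pointwise as Pointwise using (Pointwise; []; _∷_)
open import Data.List.Relation.Binary.Permutation.Propositional
open import Data.List.Relation.Binary.Permutation.Propositional.Properties
open import Data.Product using (Σ; ∃; _×_; _,_; proj₁; proj₂)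
open import Data.Empty using (⊥; ⊥-elim)
open import Data.Maybe using (Maybe; just; nothing)
open import Data.Sum using (_⊎_; inj₁; inj₂)
open import Data.Unit using (⊤; tt)
open import Relation.Nullary using (yes; no)
open import Relation.Binary.PropositionalEquality
  using (_≡_; _≢_; refl; sym; cong; cong₂; subst) renaming (trans to ≡-trans)

-- Tree isomorphism

infix 4 _≋_
_≋_ : List RT → List RT → Set
cs ≋ ds = Σ (List RT) (λ es → Pointwise _≅_ cs es × (es ↭ ds))

↭-Pointwise-commute : ∀ {A : Set} {R : A → A → Set} {xs ys zs : List A} →
  xs ↭ ys → Pointwise R ys zs → Σ (List A) (λ ws → Pointwise R xs ws × (ws ↭ zs))
↭-Pointwise-commute {zs = zs} refl P = zs , P , refl
↭-Pointwise-commute (prep x p) (r ∷ P) with ↭-Pointwise-commute p P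
... | ws , P' , q = _ , r ∷ P' , prep _ q
↭-Pointwise-commute (swap x y p) (r ∷ r' ∷ P) with ↭-Pointwise-commute p P
... | ws , P' , q = _ , r' ∷ r ∷ P' , swap _ _ q
↭-Pointwise-commute (trans p q) P with ↭-Pointwise-commute q P
... | ws , P₁ , q₁ with ↭-Pointwise-commute p P₁
... | ws' , P₂ , q₂ = ws' , P₂ , trans q₂ q₁

mutual
  ≅-refl : ∀ T → T ≅ T
  ≅-refl (nd L cs) = nd≅ refl (cs , Pointwise-≅-refl cs , refl)

  Pointwise-≅-refl : ∀ cs → Pointwise _≅_ cs cs
  Pointwise-≅-refl [] = []
  Pointwise-≅-refl (c ∷ cs) = ≅-refl c ∷ Pointwise-≅-refl cs

mutual
  ≅-sym : ∀ {S T} → S ≅ T → T ≅ S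
  ≅-sym (nd≅ p (es , P , q)) with ↭-Pointwise-commute (↭-sym q) (Pointwise-≅-sym P)
  ... | ws , P' , q' = nd≅ (↭-sym p) (ws , P' , q')

  Pointwise-≅-sym : ∀ {cs ds} → Pointwise _≅_ cs ds → Pointwise _≅_ ds cs
  Pointwise-≅-sym [] = []
  Pointwise-≅-sym (r ∷ P) = ≅-sym r ∷ Pointwise-≅-sym P

-- Transitivity is proved against a continuation so that the recursion is structural in the first proof.
≅-TransFrom : RT → RT → Set
≅-TransFrom S T = ∀ {U} → T ≅ U → S ≅ U

mutual
  ≅-trans : ∀ {S T U} → S ≅ T → T ≅ U → S ≅ U
  ≅-trans (nd≅ p (es , P , q)) (nd≅ p' (fs , P' , q')) with ↭-Pointwise-commute q P'
  ... | ws , P'' , q'' = nd≅ (trans p p') (ws , Pointwise-≅-compose (Pointwise-≅-transFrom P) P'' , trans q'' q')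

  Pointwise-≅-transFrom : ∀ {cs ds} → Pointwise _≅_ cs ds → Pointwise ≅-TransFrom cs ds
  Pointwise-≅-transFrom [] = []
  Pointwise-≅-transFrom (r ∷ P) = ≅-trans r ∷ Pointwise-≅-transFrom P

  Pointwise-≅-compose : ∀ {cs ds es} → Pointwise ≅-TransFrom cs ds → Pointwise _≅_ ds es →
    Pointwise _≅_ cs es
  Pointwise-≅-compose [] [] = []
  Pointwise-≅-compose (f ∷ P) (r ∷ Q) = f r ∷ Pointwise-≅-compose P Q

≡⇒≅ : ∀ {S T} → S ≡ T → S ≅ T
≡⇒≅ {S} refl = ≅-refl S

≋-refl : ∀ cs → cs ≋ cs
≋-refl cs = cs , Pointwise-≅-refl cs , refl

≋-trans : ∀ {cs ds es} → cs ≋ ds → ds ≋ es → cs ≋ es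
≋-trans (es , P , q) (fs , P' , q') with ↭-Pointwise-commute q P'
... | ws , P'' , q'' = ws , Pointwise-≅-compose (Pointwise-≅-transFrom P) P'' , trans q'' q'

↭⇒≋ : ∀ {cs ds} → cs ↭ ds → cs ≋ ds
↭⇒≋ {cs} p = cs , Pointwise-≅-refl cs , p

Pointwise⇒≋ : ∀ {cs ds} → Pointwise _≅_ cs ds → cs ≋ ds
Pointwise⇒≋ {ds = ds} P = ds , P , refl

≋-∷ : ∀ {c d cs ds} → c ≅ d → cs ≋ ds → (c ∷ cs) ≋ (d ∷ ds)
≋-∷ r (es , P , q) = _ , r ∷ P , prep _ q

≋-++ : ∀ {cs ds cs' ds'} → cs ≋ ds → cs' ≋ ds' → (cs ++ cs') ≋ (ds ++ ds')
≋-++ (es , P , q) (es' , P' , q') = es ++ es' , Pointwise.++⁺ P P' , ++⁺ q q'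

labels-≅ : ∀ {S T} → S ≅ T → labels S ↭ labels T
labels-≅ (nd≅ p _) = p

children-≅ : ∀ {S T} → S ≅ T → children S ≋ children T
children-≅ (nd≅ _ q) = q

allWhite-++ : ∀ xs ys → allWhite (xs ++ ys) ≡ allWhite xs ∧ allWhite ys
allWhite-++ [] ys = refl
allWhite-++ (x ∷ xs) ys with not (isRed x)
... | true = allWhite-++ xs ys
... | false = refl

isRed-withRedChild : ∀ L K S → isRed S ≡ true → isRed (nd L (K ++ S ∷ [])) ≡ false
isRed-withRedChild (y ∷ L) K S e = refl
isRed-withRedChild [] K S e rewrite allWhite-++ K (S ∷ []) | e = ∧-zeroʳ (allWhite K)

allWhite-children : ∀ S → isRed S ≡ true → allWhite (children S) ≡ true
allWhite-children (nd [] ks) e = e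

-- compose T₁ x T₂ is, definitionally, insert x applied to the relabelled trees.
insert : ℕ → RT → RT → RT
insert a S T = if isRed S then (if isSingleLeaf a T then S else insR a S T) else insW a S T

insert-red : ∀ a S T → isRed S ≡ true → isSingleLeaf a T ≡ false → insert a S T ≡ insR a S T
insert-red a S T e f rewrite e | f = refl

isRed-fuse : ∀ cs S → isRed S ≡ false → ∀ L → isRed (nd (L ++ labels S) (cs ++ children S)) ≡ false
isRed-fuse cs S e (z ∷ L) = refl
isRed-fuse cs (nd (z ∷ _) ks) e [] = refl
isRed-fuse cs (nd [] ks) e [] rewrite allWhite-++ cs ks | e = ∧-zeroʳ (allWhite cs)

mutual
  isRed-insW : ∀ a S → isRed S ≡ false → ∀ T → isRed (insW a S T) ≡ isRed T
  isRed-insW a S e (nd [] cs) = allWhite-insWL a S e cs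
  isRed-insW a S e (nd (y ∷ L) cs) with elem a (y ∷ L)
  ... | false = refl
  ... | true = isRed-fuse cs S e (removeN a (y ∷ L))

  allWhite-insWL : ∀ a S → isRed S ≡ false → ∀ cs → allWhite (insWL a S cs) ≡ allWhite cs
  allWhite-insWL a S e [] = refl
  allWhite-insWL a S e (c ∷ cs) rewrite isRed-insW a S e c | allWhite-insWL a S e cs = refl

mutual
  isRed-insR : ∀ a S → isRed S ≡ true → ∀ T → isRed (insR a S T) ≡ isRed T
  isRed-insR a S e (nd [] cs) = allWhite-insRL a S e cs
  isRed-insR a S e (nd (y ∷ L) cs) with elem a (y ∷ L)
  ... | false = refl
  ... | true = isRed-withRedChild (removeN a (y ∷ L)) cs S e

  allWhite-insRL : ∀ a S → isRed S ≡ true → ∀ cs → allWhite (insRL a S cs) ≡ allWhite cs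
  allWhite-insRL a S e [] = refl
  allWhite-insRL a S e (nd (y ∷ []) [] ∷ cs) with a ≡ᵇ y
  ... | true rewrite allWhite-++ (children S) (insRL a S cs) | allWhite-children S e
                   | allWhite-insRL a S e cs = refl
  ... | false rewrite allWhite-insRL a S e cs = refl
  allWhite-insRL a S e (c@(nd [] _) ∷ cs) rewrite isRed-insR a S e c | allWhite-insRL a S e cs = refl
  allWhite-insRL a S e (c@(nd (_ ∷ []) (_ ∷ _)) ∷ cs) rewrite isRed-insR a S e c | allWhite-insRL a S e cs = refl
  allWhite-insRL a S e (c@(nd (_ ∷ _ ∷ _) _) ∷ cs) rewrite isRed-insR a S e c | allWhite-insRL a S e cs = refl

∨-falseˡ : ∀ {a b} → a ∨ b ≡ false → a ≡ false
∨-falseˡ {false} e = refl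

∨-falseʳ : ∀ {a b} → a ∨ b ≡ false → b ≡ false
∨-falseʳ {false} e = e

≡ᵇ-refl : ∀ n → (n ≡ᵇ n) ≡ true
≡ᵇ-refl zero = refl
≡ᵇ-refl (suc n) = ≡ᵇ-refl n

T⇒≡true : ∀ {b} → T b → b ≡ true
T⇒≡true {true} _ = refl

≡true⇒T : ∀ {b} → b ≡ true → T b
≡true⇒T refl = tt

≢⇒≡ᵇ-false : ∀ m n → m ≢ n → (m ≡ᵇ n) ≡ false
≢⇒≡ᵇ-false m n ne with m ≡ᵇ n in e
... | true = ⊥-elim (ne (≡ᵇ⇒≡ m n (≡true⇒T e)))
... | false = refl

elem-++ : ∀ a xs ys → elem a (xs ++ ys) ≡ elem a xs ∨ elem a ys
elem-++ a [] ys = refl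
elem-++ a (y ∷ xs) ys rewrite elem-++ a xs ys = sym (∨-assoc (a ≡ᵇ y) (elem a xs) (elem a ys))

elem-++-false : ∀ a xs ys → elem a (xs ++ ys) ≡ false → elem a xs ≡ false × elem a ys ≡ false
elem-++-false a xs ys e rewrite elem-++ a xs ys = ∨-falseˡ e , ∨-falseʳ {elem a xs} e

removeN-++ : ∀ a xs ys → removeN a (xs ++ ys) ≡ removeN a xs ++ removeN a ys
removeN-++ a [] ys = refl
removeN-++ a (y ∷ xs) ys with a ≡ᵇ y
... | true = removeN-++ a xs ys
... | false = cong (y ∷_) (removeN-++ a xs ys)

removeN-∉ : ∀ a xs → elem a xs ≡ false → removeN a xs ≡ xs
removeN-∉ a [] e = refl
removeN-∉ a (y ∷ xs) e with a ≡ᵇ y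
... | false = cong (y ∷_) (removeN-∉ a xs e)

elem-↭ : ∀ a {xs ys} → xs ↭ ys → elem a xs ≡ elem a ys
elem-↭ a refl = refl
elem-↭ a (prep x p) = cong ((a ≡ᵇ x) ∨_) (elem-↭ a p)
elem-↭ a (swap {xs} {ys} x y p) rewrite elem-↭ a p
  | sym (∨-assoc (a ≡ᵇ x) (a ≡ᵇ y) (elem a ys)) | ∨-comm (a ≡ᵇ x) (a ≡ᵇ y) =
  ∨-assoc (a ≡ᵇ y) (a ≡ᵇ x) (elem a ys)
elem-↭ a (trans p q) = ≡-trans (elem-↭ a p) (elem-↭ a q)

removeN-↭ : ∀ a {xs ys} → xs ↭ ys → removeN a xs ↭ removeN a ys
removeN-↭ a refl = refl
removeN-↭ a (prep x p) with a ≡ᵇ x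
... | true = removeN-↭ a p
... | false = prep x (removeN-↭ a p)
removeN-↭ a (swap x y p) with a ≡ᵇ x | a ≡ᵇ y
... | true | true = removeN-↭ a p
... | true | false = prep y (removeN-↭ a p)
... | false | true = prep x (removeN-↭ a p)
... | false | false = swap x y (removeN-↭ a p)
removeN-↭ a (trans p q) = trans (removeN-↭ a p) (removeN-↭ a q)

flattenL-++ : ∀ xs ys → flattenL (xs ++ ys) ≡ flattenL xs ++ flattenL ys
flattenL-++ [] ys = refl
flattenL-++ (x ∷ xs) ys rewrite flattenL-++ xs ys = sym (List.++-assoc (flatten x) (flattenL xs) (flattenL ys))

insWL-++ : ∀ a S xs ys → insWL a S (xs ++ ys) ≡ insWL a S xs ++ insWL a S ys
insWL-++ a S [] ys = refl
insWL-++ a S (x ∷ xs) ys = cong (insW a S x ∷_) (insWL-++ a S xs ys)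

insRL-++ : ∀ a S xs ys → insRL a S (xs ++ ys) ≡ insRL a S xs ++ insRL a S ys
insRL-++ a S [] ys = refl
insRL-++ a S (x ∷ xs) ys with isSingleLeaf a x
... | true rewrite insRL-++ a S xs ys = sym (List.++-assoc (children S) (insRL a S xs) (insRL a S ys))
... | false = cong (insR a S x ∷_) (insRL-++ a S xs ys)

isSingleLeaf-∉ : ∀ a c → elem a (flatten c) ≡ false → isSingleLeaf a c ≡ false
isSingleLeaf-∉ a (nd [] k) e = refl
isSingleLeaf-∉ a (nd (y ∷ []) []) e = ∨-falseˡ e
isSingleLeaf-∉ a (nd (y ∷ []) (k ∷ ks)) e = refl
isSingleLeaf-∉ a (nd (y ∷ z ∷ L) k) e = refl

mutual
  insW-∉ : ∀ a S T → elem a (flatten T) ≡ false → insW a S T ≡ T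
  insW-∉ a S (nd L cs) e with elem-++-false a L (flattenL cs) e
  ... | eL , ecs rewrite eL = cong (nd L) (insWL-∉ a S cs ecs)

  insWL-∉ : ∀ a S cs → elem a (flattenL cs) ≡ false → insWL a S cs ≡ cs
  insWL-∉ a S [] e = refl
  insWL-∉ a S (c ∷ cs) e with elem-++-false a (flatten c) (flattenL cs) e
  ... | ec , ecs = cong₂ _∷_ (insW-∉ a S c ec) (insWL-∉ a S cs ecs)

mutual
  insR-∉ : ∀ a S T → elem a (flatten T) ≡ false → insR a S T ≡ T
  insR-∉ a S (nd L cs) e with elem-++-false a L (flattenL cs) e
  ... | eL , ecs rewrite eL = cong (nd L) (insRL-∉ a S cs ecs)

  insRL-∉ : ∀ a S cs → elem a (flattenL cs) ≡ false → insRL a S cs ≡ cs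
  insRL-∉ a S [] e = refl
  insRL-∉ a S (c ∷ cs) e with elem-++-false a (flatten c) (flattenL cs) e
  ... | ec , ecs rewrite isSingleLeaf-∉ a c ec = cong₂ _∷_ (insR-∉ a S c ec) (insRL-∉ a S cs ecs)

-- The map GR₄ → BWTS on representatives

-- A subtree enters the tree of a product either below a fresh root (asChild: a red root then dissolves
-- into its children) or by fusing with that root (asRoot: a red root then stays a child, being unlabelled).
data Mode : Set where
  asChild asRoot : Mode

rootLabels : Mode → RT → List ℕ
rootLabels asChild T = []
rootLabels asRoot T = if isRed T then [] else labels T

subtrees : Mode → RT → List RT
subtrees asChild T = if isRed T then children T else T ∷ []
subtrees asRoot T = if isRed T then T ∷ [] else children T

leftMode rightMode : Op → Mode
leftMode prec = asRoot
leftMode succ = asChild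
leftMode circ = asRoot
leftMode odot = asChild
rightMode prec = asChild
rightMode succ = asRoot
rightMode circ = asRoot
rightMode odot = asChild

product : Op → RT → RT → RT
product o A B = nd (rootLabels (leftMode o) A ++ rootLabels (rightMode o) B)
                   (subtrees (leftMode o) A ++ subtrees (rightMode o) B)

-- toRT s f is the image of s with its i-th leaf labelled f i.
toRT : FT → (ℕ → ℕ) → RT
toRT leaf f = nd (f 1 ∷ []) []
toRT (node o l r) f = product o (toRT l f) (toRT r (λ i → f (ar l + i)))

φ : FT → RT
φ s = toRT s (λ i → i)

NonEmptyNode : List ℕ → List RT → Set
NonEmptyNode [] [] = ⊥
NonEmptyNode (y ∷ L) K = ⊤
NonEmptyNode [] (k ∷ K) = ⊤

isSingleLeaf-∷ : ∀ a L c cs → isSingleLeaf a (nd L (c ∷ cs)) ≡ false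
isSingleLeaf-∷ a [] c cs = refl
isSingleLeaf-∷ a (y ∷ []) c cs = refl
isSingleLeaf-∷ a (y ∷ z ∷ L) c cs = refl

isSingleLeaf-++ : ∀ a P Q LX KX → elem a LX ≡ false → NonEmptyNode LX KX →
  isSingleLeaf a (nd (P ++ LX) (Q ++ KX)) ≡ false
isSingleLeaf-++ a P [] LX (k ∷ KX) e n = isSingleLeaf-∷ a (P ++ LX) k KX
isSingleLeaf-++ a P (q ∷ Q) LX KX e n = isSingleLeaf-∷ a (P ++ LX) q (Q ++ KX)
isSingleLeaf-++ a [] [] (y ∷ []) [] e n = ∨-falseˡ e
isSingleLeaf-++ a [] [] (y ∷ z ∷ LX) [] e n = refl
isSingleLeaf-++ a (p ∷ []) [] (y ∷ LX) [] e n = refl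
isSingleLeaf-++ a (p ∷ p' ∷ P) [] (y ∷ LX) [] e n = refl

↭-swap-suffixes : ∀ {A : Set} (xs ys zs : List A) → (xs ++ ys) ++ zs ↭ (xs ++ zs) ++ ys
↭-swap-suffixes xs ys zs = trans (↭-reflexive (List.++-assoc xs ys zs))
  (trans (++⁺ˡ xs (++-comm ys zs)) (↭-reflexive (sym (List.++-assoc xs zs ys))))

-- Inserting at a label a of the operand A of a node whose other part LX, KX avoids a.
InsertsIntoPart : Mode → ℕ → RT → RT → List ℕ → List RT → Set
InsertsIntoPart m a S A LX KX =
  insert a S (nd (rootLabels m A ++ LX) (subtrees m A ++ KX)) ≅
  nd (rootLabels m (insert a S A) ++ LX) (subtrees m (insert a S A) ++ KX)

module InsertIntoPartCases (a : ℕ) (S : RT) (LX : List ℕ) (KX : List RT)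
  (a∉LX : elem a LX ≡ false) (a∉KX : elem a (flattenL KX) ≡ false) (ne : NonEmptyNode LX KX) where

  redS-root-redA : ∀ KA → isRed S ≡ true → allWhite KA ≡ true → InsertsIntoPart asRoot a S (nd [] KA) LX KX
  redS-root-redA KA eS eA rewrite eA | eS | allWhite-insRL a S eS KA | eA | a∉LX
    | isSingleLeaf-∷ a LX (nd [] KA) KX | insRL-∉ a S KX a∉KX = ≅-refl _

  redS-root-leafA : isRed S ≡ true → InsertsIntoPart asRoot a S (nd (a ∷ []) []) LX KX
  redS-root-leafA eS
    rewrite insert-red a S (nd (a ∷ LX) KX) eS (isSingleLeaf-++ a (a ∷ []) [] LX KX a∉LX ne)
    | ≡ᵇ-refl a | removeN-∉ a LX a∉LX | eS | eS
    = nd≅ refl (↭⇒≋ (++-comm KX (S ∷ [])))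

  redS-root-labelledA : ∀ LA KA → isRed S ≡ true → isRed (nd LA KA) ≡ false →
    isSingleLeaf a (nd LA KA) ≡ false → elem a LA ≡ true → InsertsIntoPart asRoot a S (nd LA KA) LX KX
  redS-root-labelledA LA KA eS eA sl eLA
    rewrite eA | insert-red a S (nd (LA ++ LX) (KA ++ KX)) eS (isSingleLeaf-++ a LA KA LX KX a∉LX ne)
    | elem-++ a LA LX | eLA | eS | sl | isRed-withRedChild (removeN a LA) KA S eS
    | removeN-++ a LA LX | removeN-∉ a LX a∉LX
    = nd≅ refl (↭⇒≋ (↭-swap-suffixes KA KX (S ∷ [])))

  redS-root-deepA : ∀ LA KA → isRed S ≡ true → isRed (nd LA KA) ≡ false →
    isSingleLeaf a (nd LA KA) ≡ false → elem a LA ≡ false → InsertsIntoPart asRoot a S (nd LA KA) LX KX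
  redS-root-deepA [] KA eS eA sl eLA
    rewrite eA | insert-red a S (nd LX (KA ++ KX)) eS (isSingleLeaf-++ a [] KA LX KX a∉LX ne)
    | a∉LX | eS | allWhite-insRL a S eS KA | eA | insRL-++ a S KA KX | insRL-∉ a S KX a∉KX = ≅-refl _
  redS-root-deepA (y ∷ LA) KA eS eA sl eLA
    rewrite insert-red a S (nd ((y ∷ LA) ++ LX) (KA ++ KX)) eS (isSingleLeaf-++ a (y ∷ LA) KA LX KX a∉LX ne)
    | elem-++ a (y ∷ LA) LX | eLA | a∉LX | eS | sl
    | insRL-++ a S KA KX | insRL-∉ a S KX a∉KX = ≅-refl _

  redS-child-redA : ∀ KA → isRed S ≡ true → allWhite KA ≡ true → InsertsIntoPart asChild a S (nd [] KA) LX KX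
  redS-child-redA KA eS eA
    rewrite eA | insert-red a S (nd LX (KA ++ KX)) eS (isSingleLeaf-++ a [] KA LX KX a∉LX ne)
    | a∉LX | eS | allWhite-insRL a S eS KA | eA | insRL-++ a S KA KX | insRL-∉ a S KX a∉KX = ≅-refl _

  redS-child-leafA : isRed S ≡ true → InsertsIntoPart asChild a S (nd (a ∷ []) []) LX KX
  redS-child-leafA eS
    rewrite insert-red a S (nd LX (nd (a ∷ []) [] ∷ KX)) eS (isSingleLeaf-∷ a LX (nd (a ∷ []) []) KX)
    | a∉LX | ≡ᵇ-refl a | eS | insRL-∉ a S KX a∉KX | eS = ≅-refl _

  redS-child-whiteA : ∀ A → isRed S ≡ true → isRed A ≡ false →
    isSingleLeaf a A ≡ false → InsertsIntoPart asChild a S A LX KX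
  redS-child-whiteA A eS eA sl
    rewrite eA | insert-red a S (nd LX (A ∷ KX)) eS (isSingleLeaf-∷ a LX A KX)
    | a∉LX | sl | eS | isRed-insR a S eS A | eA | insRL-∉ a S KX a∉KX = ≅-refl _

  whiteS-root-redA : ∀ KA → isRed S ≡ false → allWhite KA ≡ true → InsertsIntoPart asRoot a S (nd [] KA) LX KX
  whiteS-root-redA KA eS eA
    rewrite eA | eS | a∉LX | allWhite-insWL a S eS KA | eA | insWL-∉ a S KX a∉KX = ≅-refl _

  whiteS-root-labelledA : ∀ LA KA → isRed S ≡ false → isRed (nd LA KA) ≡ false →
    elem a LA ≡ true → InsertsIntoPart asRoot a S (nd LA KA) LX KX
  whiteS-root-labelledA LA KA eS eA eLA
    rewrite eA | eS | elem-++ a LA LX | eLA | isRed-fuse KA S eS (removeN a LA)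
    | removeN-++ a LA LX | removeN-∉ a LX a∉LX
    = nd≅ (↭-swap-suffixes (removeN a LA) LX (labels S)) (↭⇒≋ (↭-swap-suffixes KA KX (children S)))

  whiteS-root-deepA : ∀ LA KA → isRed S ≡ false → isRed (nd LA KA) ≡ false →
    elem a LA ≡ false → InsertsIntoPart asRoot a S (nd LA KA) LX KX
  whiteS-root-deepA [] KA eS eA eLA
    rewrite eA | eS | a∉LX | allWhite-insWL a S eS KA | eA | insWL-++ a S KA KX | insWL-∉ a S KX a∉KX = ≅-refl _
  whiteS-root-deepA (y ∷ LA) KA eS eA eLA
    rewrite eS | elem-++ a (y ∷ LA) LX | eLA | a∉LX
    | insWL-++ a S KA KX | insWL-∉ a S KX a∉KX = ≅-refl _

  whiteS-child-redA : ∀ KA → isRed S ≡ false → allWhite KA ≡ true → InsertsIntoPart asChild a S (nd [] KA) LX KX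
  whiteS-child-redA KA eS eA
    rewrite eA | eS | a∉LX | allWhite-insWL a S eS KA | eA | insWL-++ a S KA KX | insWL-∉ a S KX a∉KX = ≅-refl _

  whiteS-child-whiteA : ∀ A → isRed S ≡ false → isRed A ≡ false → InsertsIntoPart asChild a S A LX KX
  whiteS-child-whiteA A eS eA
    rewrite eA | eS | a∉LX | isRed-insW a S eS A | eA | insWL-∉ a S KX a∉KX = ≅-refl _

  whiteA : ∀ m LA KA → isRed (nd LA KA) ≡ false → isSingleLeaf a (nd LA KA) ≡ false →
    ∀ s l → isRed S ≡ s → elem a LA ≡ l → InsertsIntoPart m a S (nd LA KA) LX KX
  whiteA asRoot LA KA eA sl true true eS eLA = redS-root-labelledA LA KA eS eA sl eLA
  whiteA asRoot LA KA eA sl true false eS eLA = redS-root-deepA LA KA eS eA sl eLA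
  whiteA asRoot LA KA eA sl false true eS eLA = whiteS-root-labelledA LA KA eS eA eLA
  whiteA asRoot LA KA eA sl false false eS eLA = whiteS-root-deepA LA KA eS eA eLA
  whiteA asChild LA KA eA sl true _ eS _ = redS-child-whiteA (nd LA KA) eS eA sl
  whiteA asChild LA KA eA sl false _ eS _ = whiteS-child-whiteA (nd LA KA) eS eA

  redA : ∀ m KA → allWhite KA ≡ true → ∀ s → isRed S ≡ s → InsertsIntoPart m a S (nd [] KA) LX KX
  redA asRoot KA eA true eS = redS-root-redA KA eS eA
  redA asRoot KA eA false eS = whiteS-root-redA KA eS eA
  redA asChild KA eA true eS = redS-child-redA KA eS eA
  redA asChild KA eA false eS = whiteS-child-redA KA eS eA

  leafA : ∀ m s → isRed S ≡ s → InsertsIntoPart m a S (nd (a ∷ []) []) LX KX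
  leafA asRoot true eS = redS-root-leafA eS
  leafA asRoot false eS = whiteS-root-labelledA (a ∷ []) [] eS refl (cong (_∨ false) (≡ᵇ-refl a))
  leafA asChild true eS = redS-child-leafA eS
  leafA asChild false eS = whiteS-child-whiteA (nd (a ∷ []) []) eS refl

  white : ∀ m LA KA → isRed (nd LA KA) ≡ false → isSingleLeaf a (nd LA KA) ≡ false →
    InsertsIntoPart m a S (nd LA KA) LX KX
  white m LA KA eA sl = whiteA m LA KA eA sl _ _ refl refl

  singletonA : ∀ m y b → (a ≡ᵇ y) ≡ b → InsertsIntoPart m a S (nd (y ∷ []) []) LX KX
  singletonA m y true ea rewrite sym (≡ᵇ⇒≡ a y (≡true⇒T ea)) = leafA m _ refl
  singletonA m y false ea = white m (y ∷ []) [] refl ea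

  unlabelledA : ∀ m KA b → allWhite KA ≡ b → InsertsIntoPart m a S (nd [] KA) LX KX
  unlabelledA m KA true eA = redA m KA eA _ refl
  unlabelledA m KA false eA = white m [] KA eA refl

  intoPart : ∀ m A → InsertsIntoPart m a S A LX KX
  intoPart m (nd [] KA) = unlabelledA m KA _ refl
  intoPart m (nd (y ∷ []) []) = singletonA m y _ refl
  intoPart m (nd (y ∷ []) (k ∷ ks)) = white m (y ∷ []) (k ∷ ks) refl (isSingleLeaf-∷ a (y ∷ []) k ks)
  intoPart m (nd (y ∷ z ∷ LA) KA) = white m (y ∷ z ∷ LA) KA refl refl

insertIntoPart : ∀ m a S A LX KX → elem a LX ≡ false → elem a (flattenL KX) ≡ false →
  NonEmptyNode LX KX → InsertsIntoPart m a S A LX KX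
insertIntoPart m a S A LX KX a∉LX a∉KX ne = InsertIntoPartCases.intoPart a S LX KX a∉LX a∉KX ne m A

-- Invariance under tree isomorphism

allWhite-↭ : ∀ {xs ys} → xs ↭ ys → allWhite xs ≡ allWhite ys
allWhite-↭ refl = refl
allWhite-↭ (prep x p) = cong (not (isRed x) ∧_) (allWhite-↭ p)
allWhite-↭ (swap {xs} {ys} x y p) rewrite allWhite-↭ p
  | sym (∧-assoc (not (isRed x)) (not (isRed y)) (allWhite ys)) | ∧-comm (not (isRed x)) (not (isRed y)) =
  ∧-assoc (not (isRed y)) (not (isRed x)) (allWhite ys)
allWhite-↭ (trans p q) = ≡-trans (allWhite-↭ p) (allWhite-↭ q)

[]↭⇒≡[] : ∀ {A : Set} {xs : List A} → [] ↭ xs → xs ≡ []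
[]↭⇒≡[] p = ↭-empty-inv (↭-sym p)

∷↭⇒∷ : ∀ {A : Set} {x : A} {xs ys} → (x ∷ xs) ↭ ys → ∃ λ y → ∃ λ ys' → ys ≡ y ∷ ys'
∷↭⇒∷ {ys = []} p = ⊥-elim (¬x∷xs↭[] p)
∷↭⇒∷ {ys = y ∷ ys} p = y , ys , refl

mutual
  isRed-≅ : ∀ {S T} → S ≅ T → isRed S ≡ isRed T
  isRed-≅ (nd≅ {[]} p (es , P , q)) rewrite []↭⇒≡[] p = ≡-trans (allWhite-Pointwise P) (allWhite-↭ q)
  isRed-≅ (nd≅ {y ∷ L} p _) with ∷↭⇒∷ p
  ... | _ , _ , refl = refl

  allWhite-Pointwise : ∀ {cs es} → Pointwise _≅_ cs es → allWhite cs ≡ allWhite es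
  allWhite-Pointwise [] = refl
  allWhite-Pointwise (r ∷ P) rewrite isRed-≅ r | allWhite-Pointwise P = refl

allWhite-≋ : ∀ {R R'} → R ≋ R' → allWhite R ≡ allWhite R'
allWhite-≋ (es , P , q) = ≡-trans (allWhite-Pointwise P) (allWhite-↭ q)

concatMap-↭ : ∀ {A B : Set} (f : A → List B) {xs ys} → xs ↭ ys → concatMap f xs ↭ concatMap f ys
concatMap-↭ f refl = refl
concatMap-↭ f (prep x p) = ++⁺ˡ (f x) (concatMap-↭ f p)
concatMap-↭ f (swap x y p) = trans (++⁺ˡ (f x) (++⁺ˡ (f y) (concatMap-↭ f p))) (shifts (f x) (f y))
concatMap-↭ f (trans p q) = trans (concatMap-↭ f p) (concatMap-↭ f q)

flattenL≡concatMap : ∀ cs → flattenL cs ≡ concatMap flatten cs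
flattenL≡concatMap [] = refl
flattenL≡concatMap (c ∷ cs) = cong (flatten c ++_) (flattenL≡concatMap cs)

flattenL-↭ : ∀ {cs ds} → cs ↭ ds → flattenL cs ↭ flattenL ds
flattenL-↭ {cs} {ds} q rewrite flattenL≡concatMap cs | flattenL≡concatMap ds = concatMap-↭ flatten q

mutual
  flatten-≅ : ∀ {S T} → S ≅ T → flatten S ↭ flatten T
  flatten-≅ (nd≅ p (es , P , q)) = ++⁺ p (trans (flattenL-Pointwise P) (flattenL-↭ q))

  flattenL-Pointwise : ∀ {cs es} → Pointwise _≅_ cs es → flattenL cs ↭ flattenL es
  flattenL-Pointwise [] = refl
  flattenL-Pointwise (r ∷ P) = ++⁺ (flatten-≅ r) (flattenL-Pointwise P)

weight-≅ : ∀ {S T} → S ≅ T → weight S ≡ weight T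
weight-≅ r = ↭-length (flatten-≅ r)

isSingleLeaf-≅ : ∀ a {S T} → S ≅ T → isSingleLeaf a S ≡ isSingleLeaf a T
isSingleLeaf-≅ a (nd≅ {L} {L'} {c ∷ cs} p (e ∷ es , r ∷ P , q)) with ∷↭⇒∷ q
... | d , ds , refl = ≡-trans (isSingleLeaf-∷ a L c cs) (sym (isSingleLeaf-∷ a L' d ds))
isSingleLeaf-≅ a (nd≅ {L} {L'} {[]} p ([] , [] , q)) rewrite []↭⇒≡[] q = leafLabels L L' p
  where
  leafLabels : ∀ L L' → L ↭ L' → isSingleLeaf a (nd L []) ≡ isSingleLeaf a (nd L' [])
  leafLabels [] L' p rewrite []↭⇒≡[] p = refl
  leafLabels (y ∷ []) L' p rewrite ↭-singleton-inv (↭-sym p) = refl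
  leafLabels (y ∷ z ∷ L) [] p with ↭-length p
  ... | ()
  leafLabels (y ∷ z ∷ L) (w ∷ []) p with ↭-length p
  ... | ()
  leafLabels (y ∷ z ∷ L) (w ∷ v ∷ L') p = refl

insWL≡map : ∀ a S cs → insWL a S cs ≡ map (insW a S) cs
insWL≡map a S [] = refl
insWL≡map a S (c ∷ cs) = cong (insW a S c ∷_) (insWL≡map a S cs)

insRL≡concatMap : ∀ a S cs →
  insRL a S cs ≡ concatMap (λ c → if isSingleLeaf a c then children S else insR a S c ∷ []) cs
insRL≡concatMap a S [] = refl
insRL≡concatMap a S (c ∷ cs) with isSingleLeaf a c
... | true = cong (children S ++_) (insRL≡concatMap a S cs)
... | false = cong (insR a S c ∷_) (insRL≡concatMap a S cs)

insWL-↭ : ∀ a S {cs ds} → cs ↭ ds → insWL a S cs ↭ insWL a S ds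
insWL-↭ a S {cs} {ds} p rewrite insWL≡map a S cs | insWL≡map a S ds = map⁺ (insW a S) p

insRL-↭ : ∀ a S {cs ds} → cs ↭ ds → insRL a S cs ↭ insRL a S ds
insRL-↭ a S {cs} {ds} p rewrite insRL≡concatMap a S cs | insRL≡concatMap a S ds = concatMap-↭ _ p

mutual
  insW-cong : ∀ a {S S' T T'} → S ≅ S' → T ≅ T' → insW a S T ≅ insW a S' T'
  insW-cong a {S' = S'} rS (nd≅ {L} p (es , P , q)) rewrite sym (elem-↭ a p) with elem a L
  ... | true = nd≅ (++⁺ (removeN-↭ a p) (labels-≅ rS)) (≋-++ (es , P , q) (children-≅ rS))
  ... | false = nd≅ p (≋-trans (insWL-Pointwise a rS P) (↭⇒≋ (insWL-↭ a S' q)))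

  insWL-Pointwise : ∀ a {S S' cs es} → S ≅ S' → Pointwise _≅_ cs es → insWL a S cs ≋ insWL a S' es
  insWL-Pointwise a rS [] = ≋-refl []
  insWL-Pointwise a rS (r ∷ P) = ≋-∷ (insW-cong a rS r) (insWL-Pointwise a rS P)

mutual
  insR-cong : ∀ a {S S' T T'} → S ≅ S' → T ≅ T' → insR a S T ≅ insR a S' T'
  insR-cong a {S' = S'} rS (nd≅ {L} p (es , P , q)) rewrite sym (elem-↭ a p) with elem a L
  ... | true = nd≅ (removeN-↭ a p) (≋-++ (es , P , q) (≋-∷ rS (≋-refl [])))
  ... | false = nd≅ p (≋-trans (insRL-Pointwise a rS P) (↭⇒≋ (insRL-↭ a S' q)))

  insRL-Pointwise : ∀ a {S S' cs es} → S ≅ S' → Pointwise _≅_ cs es → insRL a S cs ≋ insRL a S' es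
  insRL-Pointwise a rS [] = ≋-refl []
  insRL-Pointwise a {cs = c ∷ _} rS (r ∷ P) rewrite sym (isSingleLeaf-≅ a r) with isSingleLeaf a c
  ... | true = ≋-++ (children-≅ rS) (insRL-Pointwise a rS P)
  ... | false = ≋-∷ (insR-cong a rS r) (insRL-Pointwise a rS P)

insert-cong : ∀ a {S S' T T'} → S ≅ S' → T ≅ T' → insert a S T ≅ insert a S' T'
insert-cong a {S} {T = T} rS rT rewrite sym (isRed-≅ rS) | sym (isSingleLeaf-≅ a rT)
  with isRed S | isSingleLeaf a T
... | true | true = rS
... | true | false = insR-cong a rS rT
... | false | _ = insW-cong a rS rT

relabelAfter : ℕ → ℕ → ℕ → ℕ
relabelAfter x k y = if x <ᵇ y then y + k ∸ 1 else y

shiftBy : ℕ → ℕ → ℕ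
shiftBy x y = y + x ∸ 1

mapN≡map : ∀ f L → mapN f L ≡ map f L
mapN≡map f [] = refl
mapN≡map f (y ∷ L) = cong (f y ∷_) (mapN≡map f L)

mapLabL≡map : ∀ f cs → mapLabL f cs ≡ map (mapLab f) cs
mapLabL≡map f [] = refl
mapLabL≡map f (c ∷ cs) = cong (mapLab f c ∷_) (mapLabL≡map f cs)

mapLabL-↭ : ∀ f {cs ds} → cs ↭ ds → mapLabL f cs ↭ mapLabL f ds
mapLabL-↭ f {cs} {ds} q rewrite mapLabL≡map f cs | mapLabL≡map f ds = map⁺ (mapLab f) q

mutual
  mapLab-cong : ∀ f {S T} → S ≅ T → mapLab f S ≅ mapLab f T
  mapLab-cong f (nd≅ {L} {L'} p (es , P , q)) rewrite mapN≡map f L | mapN≡map f L' =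
    nd≅ (map⁺ f p) (≋-trans (mapLabL-Pointwise f P) (↭⇒≋ (mapLabL-↭ f q)))

  mapLabL-Pointwise : ∀ f {cs es} → Pointwise _≅_ cs es → mapLabL f cs ≋ mapLabL f es
  mapLabL-Pointwise f [] = ≋-refl []
  mapLabL-Pointwise f (r ∷ P) = ≋-∷ (mapLab-cong f r) (mapLabL-Pointwise f P)

compose-cong : ∀ {T₁ T₁' T₂ T₂'} x → T₁ ≅ T₁' → T₂ ≅ T₂' → compose T₁ x T₂ ≅ compose T₁' x T₂'
compose-cong {T₂' = T₂'} x r₁ r₂ rewrite weight-≅ r₂ =
  insert-cong x (mapLab-cong (shiftBy x) r₂) (mapLab-cong (relabelAfter x (weight T₂')) r₁)

mutual
  isRed-mapLab : ∀ g T → isRed (mapLab g T) ≡ isRed T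
  isRed-mapLab g (nd [] cs) = allWhite-mapLabL g cs
  isRed-mapLab g (nd (y ∷ L) cs) = refl

  allWhite-mapLabL : ∀ g cs → allWhite (mapLabL g cs) ≡ allWhite cs
  allWhite-mapLabL g [] = refl
  allWhite-mapLabL g (c ∷ cs) rewrite isRed-mapLab g c | allWhite-mapLabL g cs = refl

mapN-++ : ∀ g xs ys → mapN g (xs ++ ys) ≡ mapN g xs ++ mapN g ys
mapN-++ g [] ys = refl
mapN-++ g (x ∷ xs) ys = cong (g x ∷_) (mapN-++ g xs ys)

mapLabL-++ : ∀ g xs ys → mapLabL g (xs ++ ys) ≡ mapLabL g xs ++ mapLabL g ys
mapLabL-++ g [] ys = refl
mapLabL-++ g (x ∷ xs) ys = cong (mapLab g x ∷_) (mapLabL-++ g xs ys)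

rootLabels-mapLab : ∀ m g T → mapN g (rootLabels m T) ≡ rootLabels m (mapLab g T)
rootLabels-mapLab asChild g T = refl
rootLabels-mapLab asRoot g T@(nd L cs) rewrite isRed-mapLab g T with isRed T
... | true = refl
... | false = refl

subtrees-mapLab : ∀ m g T → mapLabL g (subtrees m T) ≡ subtrees m (mapLab g T)
subtrees-mapLab asChild g T@(nd L cs) rewrite isRed-mapLab g T with isRed T
... | true = refl
... | false = refl
subtrees-mapLab asRoot g T@(nd L cs) rewrite isRed-mapLab g T with isRed T
... | true = refl
... | false = refl

mapLab-product : ∀ o g A B → mapLab g (product o A B) ≡ product o (mapLab g A) (mapLab g B)
mapLab-product o g A B
  rewrite mapN-++ g (rootLabels (leftMode o) A) (rootLabels (rightMode o) B)
  | mapLabL-++ g (subtrees (leftMode o) A) (subtrees (rightMode o) B)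
  | rootLabels-mapLab (leftMode o) g A | rootLabels-mapLab (rightMode o) g B
  | subtrees-mapLab (leftMode o) g A | subtrees-mapLab (rightMode o) g B = refl

mapLab-toRT : ∀ g s f → mapLab g (toRT s f) ≡ toRT s (λ i → g (f i))
mapLab-toRT g leaf f = refl
mapLab-toRT g (node o l r) f rewrite mapLab-product o g (toRT l f) (toRT r (λ i → f (ar l + i)))
  | mapLab-toRT g l f | mapLab-toRT g r (λ i → f (ar l + i)) = refl

toRT-ext : ∀ s f f' → (∀ i → 1 ≤ i → i ≤ ar s → f i ≡ f' i) → toRT s f ≡ toRT s f'
toRT-ext leaf f f' h rewrite h 1 (s≤s z≤n) (s≤s z≤n) = refl
toRT-ext (node o l r) f f' h =
  cong₂ (product o) (toRT-ext l f f' (λ i p q → h i p (≤-trans q (m≤m+n (ar l) (ar r)))))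
                    (toRT-ext r _ _ (λ i p q → h (ar l + i) (≤-trans p (m≤n+m i (ar l))) (+-monoʳ-≤ (ar l) q)))

leafLabels : FT → (ℕ → ℕ) → List ℕ
leafLabels leaf f = f 1 ∷ []
leafLabels (node o l r) f = leafLabels l f ++ leafLabels r (λ i → f (ar l + i))

length-leafLabels : ∀ s f → length (leafLabels s f) ≡ ar s
length-leafLabels leaf f = refl
length-leafLabels (node o l r) f
  rewrite List.length-++ (leafLabels l f) {leafLabels r (λ i → f (ar l + i))}
  | length-leafLabels l f | length-leafLabels r (λ i → f (ar l + i)) = refl

flatten-mode : ∀ m T → rootLabels m T ++ flattenL (subtrees m T) ↭ flatten T
flatten-mode asChild (nd (y ∷ L) cs) = ++-identityʳ _
flatten-mode asRoot (nd (y ∷ L) cs) = refl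
flatten-mode asChild (nd [] cs) with allWhite cs
... | true = refl
... | false = ++-identityʳ _
flatten-mode asRoot (nd [] cs) with allWhite cs
... | true = ++-identityʳ _
... | false = refl

↭-middle-swap : ∀ {A : Set} (a b c d : List A) → (a ++ b) ++ (c ++ d) ↭ (a ++ c) ++ (b ++ d)
↭-middle-swap a b c d = trans (↭-reflexive (List.++-assoc a b (c ++ d)))
  (trans (++⁺ˡ a (shifts b c)) (↭-reflexive (sym (List.++-assoc a c (b ++ d)))))

flatten-product : ∀ o A B → flatten (product o A B) ↭ flatten A ++ flatten B
flatten-product o A B rewrite flattenL-++ (subtrees (leftMode o) A) (subtrees (rightMode o) B) =
  trans (↭-middle-swap (rootLabels (leftMode o) A) (rootLabels (rightMode o) B)
                       (flattenL (subtrees (leftMode o) A)) (flattenL (subtrees (rightMode o) B)))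
        (++⁺ (flatten-mode (leftMode o) A) (flatten-mode (rightMode o) B))

flatten-toRT : ∀ s f → flatten (toRT s f) ↭ leafLabels s f
flatten-toRT leaf f = refl
flatten-toRT (node o l r) f = trans (flatten-product o (toRT l f) (toRT r (λ i → f (ar l + i))))
  (++⁺ (flatten-toRT l f) (flatten-toRT r (λ i → f (ar l + i))))

weight-toRT : ∀ s f → weight (toRT s f) ≡ ar s
weight-toRT s f = ≡-trans (↭-length (flatten-toRT s f)) (length-leafLabels s f)

elem-leafLabels : ∀ s f a → (∀ i → 1 ≤ i → i ≤ ar s → f i ≢ a) → elem a (leafLabels s f) ≡ false
elem-leafLabels leaf f a h rewrite ≢⇒≡ᵇ-false a (f 1) (λ e → h 1 (s≤s z≤n) (s≤s z≤n) (sym e)) = refl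
elem-leafLabels (node o l r) f a h rewrite elem-++ a (leafLabels l f) (leafLabels r (λ i → f (ar l + i)))
  | elem-leafLabels l f a (λ i p q → h i p (≤-trans q (m≤m+n (ar l) (ar r))))
  = elem-leafLabels r _ a (λ i p q → h (ar l + i) (≤-trans p (m≤n+m i (ar l))) (+-monoʳ-≤ (ar l) q))

elem-toRT : ∀ s f a → (∀ i → 1 ≤ i → i ≤ ar s → f i ≢ a) → elem a (flatten (toRT s f)) ≡ false
elem-toRT s f a h = ≡-trans (elem-↭ a (flatten-toRT s f)) (elem-leafLabels s f a h)

elem-mode : ∀ m T a → elem a (flatten T) ≡ false →
  elem a (rootLabels m T) ≡ false × elem a (flattenL (subtrees m T)) ≡ false
elem-mode m T a e = elem-++-false a (rootLabels m T) (flattenL (subtrees m T))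
  (≡-trans (elem-↭ a (flatten-mode m T)) e)

NonEmpty : RT → Set
NonEmpty T = NonEmptyNode (labels T) (children T)

NonEmpty-mode : ∀ m T → NonEmpty T → NonEmptyNode (rootLabels m T) (subtrees m T)
NonEmpty-mode m (nd [] []) ()
NonEmpty-mode asChild (nd [] (c ∷ cs)) n with allWhite (c ∷ cs)
... | true = tt
... | false = tt
NonEmpty-mode asRoot (nd [] (c ∷ cs)) n with allWhite (c ∷ cs)
... | true = tt
... | false = tt
NonEmpty-mode asChild (nd (y ∷ L) cs) n = tt
NonEmpty-mode asRoot (nd (y ∷ L) cs) n = tt

NonEmpty-product : ∀ o A B → NonEmpty A → NonEmpty (product o A B)
NonEmpty-product o A B n with rootLabels (leftMode o) A | subtrees (leftMode o) A | NonEmpty-mode (leftMode o) A n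
... | y ∷ _ | _ | _ = tt
... | [] | k ∷ _ | _ with rootLabels (rightMode o) B
...   | [] = tt
...   | _ ∷ _ = tt

NonEmpty-toRT : ∀ s f → NonEmpty (toRT s f)
NonEmpty-toRT leaf f = tt
NonEmpty-toRT (node o l r) f = NonEmpty-product o (toRT l f) _ (NonEmpty-toRT l f)

rootLabels-cong : ∀ m {A A'} → A ≅ A' → rootLabels m A ↭ rootLabels m A'
rootLabels-cong asChild r = refl
rootLabels-cong asRoot {A} r rewrite sym (isRed-≅ r) with isRed A
... | true = refl
... | false = labels-≅ r

subtrees-cong : ∀ m {A A'} → A ≅ A' → subtrees m A ≋ subtrees m A'
subtrees-cong asChild {A} r rewrite sym (isRed-≅ r) with isRed A
... | true = children-≅ r
... | false = ≋-∷ r (≋-refl [])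
subtrees-cong asRoot {A} r rewrite sym (isRed-≅ r) with isRed A
... | true = ≋-∷ r (≋-refl [])
... | false = children-≅ r

product-cong : ∀ o {A A' B B'} → A ≅ A' → B ≅ B' → product o A B ≅ product o A' B'
product-cong o rA rB = nd≅ (++⁺ (rootLabels-cong (leftMode o) rA) (rootLabels-cong (rightMode o) rB))
                           (≋-++ (subtrees-cong (leftMode o) rA) (subtrees-cong (rightMode o) rB))

insert-productˡ : ∀ o a S A B → elem a (flatten B) ≡ false → NonEmpty B →
  insert a S (product o A B) ≅ product o (insert a S A) B
insert-productˡ o a S A B a∉B neB with elem-mode (rightMode o) B a a∉B
... | a∉LB , a∉KB = insertIntoPart (leftMode o) a S A _ _ a∉LB a∉KB (NonEmpty-mode (rightMode o) B neB)

insert-productʳ : ∀ o a S A B → elem a (flatten A) ≡ false → NonEmpty A →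
  insert a S (product o A B) ≅ product o A (insert a S B)
insert-productʳ o a S A B a∉A neA with elem-mode (leftMode o) A a a∉A
... | a∉LA , a∉KA =
  ≅-trans (insert-cong a (≅-refl S) (nd≅ (++-comm LA LB) (↭⇒≋ (++-comm KA KB))))
  (≅-trans (insertIntoPart (rightMode o) a S B LA KA a∉LA a∉KA (NonEmpty-mode (leftMode o) A neA))
           (nd≅ (++-comm (rootLabels (rightMode o) (insert a S B)) LA)
                (↭⇒≋ (++-comm (subtrees (rightMode o) (insert a S B)) KA))))
  where
  LA = rootLabels (leftMode o) A
  LB = rootLabels (rightMode o) B
  KA = subtrees (leftMode o) A
  KB = subtrees (rightMode o) B

-- Compatibility with partial composition

<ᵇ-true : ∀ {i x} → i < x → (i <ᵇ x) ≡ true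
<ᵇ-true p = T⇒≡true (<⇒<ᵇ p)

<ᵇ-false : ∀ {i x} → x ≤ i → (i <ᵇ x) ≡ false
<ᵇ-false {i} {x} p with i <ᵇ x in e
... | true = ⊥-elim (<⇒≱ (<ᵇ⇒< i x (≡true⇒T e)) p)
... | false = refl

≤ᵇ-true : ∀ {i x} → i ≤ x → (i ≤ᵇ x) ≡ true
≤ᵇ-true p = T⇒≡true (≤⇒≤ᵇ p)

≤ᵇ-false : ∀ {i x} → x < i → (i ≤ᵇ x) ≡ false
≤ᵇ-false {i} {x} p with i ≤ᵇ x in e
... | true = ⊥-elim (<⇒≱ p (≤ᵇ⇒≤ i x (≡true⇒T e)))
... | false = refl

-- The leaf labelling of graft s x t: f on the leaves of s, g (reindexed) on those of t.
splice : ℕ → ℕ → (ℕ → ℕ) → (ℕ → ℕ) → ℕ → ℕ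
splice x n f g i = if i <ᵇ x then f i else (if i <ᵇ x + n then g (suc (i ∸ x)) else f (suc i ∸ n))

splice-below : ∀ {x n f g i} → i < x → splice x n f g i ≡ f i
splice-below p rewrite <ᵇ-true p = refl

splice-inside : ∀ {x n f g i} → x ≤ i → i < x + n → splice x n f g i ≡ g (suc (i ∸ x))
splice-inside p q rewrite <ᵇ-false p | <ᵇ-true q = refl

splice-above : ∀ {x n f g i} → x + n ≤ i → splice x n f g i ≡ f (suc i ∸ n)
splice-above {x} {n} p rewrite <ᵇ-false (≤-trans (m≤m+n x n) p) | <ᵇ-false p = refl

graft-left : ∀ o l r x t → x ≤ ar l → graft (node o l r) x t ≡ node o (graft l x t) r
graft-left o l r x t p rewrite ≤ᵇ-true p = refl

graft-right : ∀ o l r x t → ar l < x → graft (node o l r) x t ≡ node o l (graft r (x ∸ ar l) t)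
graft-right o l r x t p rewrite ≤ᵇ-false p = refl

ar≥1 : ∀ s → 1 ≤ ar s
ar≥1 leaf = s≤s z≤n
ar≥1 (node o l r) = ≤-trans (ar≥1 l) (m≤m+n (ar l) (ar r))

RightPosition : FT → FT → ℕ → Set
RightPosition l r x = ∃ λ x' → (ar l + x' ≡ x) × (1 ≤ x') × (x' ≤ ar r)

rightPosition : ∀ o l r x → ar l < x → x ≤ ar (node o l r) → RightPosition l r x
rightPosition o l r x lt q with m≤n⇒∃[o]m+o≡n (<⇒≤ lt)
... | x' , refl = x' , refl ,
  +-cancelˡ-< (ar l) 0 x' (subst (_< ar l + x') (sym (+-identityʳ (ar l))) lt) ,
  +-cancelˡ-≤ (ar l) x' (ar r) q

+-exchange : ∀ a b c → a + c + b ≡ a + b + c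
+-exchange a b c rewrite +-assoc a c b | +-comm c b = sym (+-assoc a b c)

ar-graft : ∀ s x t → 1 ≤ x → x ≤ ar s → suc (ar (graft s x t)) ≡ ar s + ar t
ar-graft leaf (suc zero) t p q = refl
ar-graft leaf (suc (suc x)) t p (s≤s ())
ar-graft (node o l r) x t p q with x ≤? ar l
... | yes x≤l rewrite graft-left o l r x t x≤l =
  ≡-trans (cong (_+ ar r) (ar-graft l x t p x≤l)) (+-exchange (ar l) (ar r) (ar t))
... | no x≰l with rightPosition o l r x (≰⇒> x≰l) q
... | x' , refl , p' , q' rewrite graft-right o l r (ar l + x') t (≰⇒> x≰l) | m+n∸m≡n (ar l) x' =
  ≡-trans (sym (+-suc (ar l) _))
    (≡-trans (cong (ar l +_) (ar-graft r x' t p' q')) (sym (+-assoc (ar l) (ar r) (ar t))))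

insert-leaf : ∀ a S → insert a S (nd (a ∷ []) []) ≡ S
insert-leaf a S@(nd LS KS) with isRed S
... | true rewrite ≡ᵇ-refl a = refl
... | false rewrite ≡ᵇ-refl a = refl

Isolates : FT → (ℕ → ℕ) → ℕ → Set
Isolates s f x = ∀ i → 1 ≤ i → i ≤ ar s → i ≢ x → f i ≢ f x

GraftsAs : FT → ℕ → FT → (ℕ → ℕ) → (ℕ → ℕ) → Set
GraftsAs s x t f g = toRT (graft s x t) (splice x (ar t) f g) ≅ insert (f x) (toRT t g) (toRT s f)

mutual
  toRT-graft : ∀ s x t f g → 1 ≤ x → x ≤ ar s → Isolates s f x → GraftsAs s x t f g
  toRT-graft leaf (suc zero) t f g p q d rewrite insert-leaf (f 1) (toRT t g) =
    ≡⇒≅ (toRT-ext t _ g λ { (suc j) _ j<n → splice-inside {1} {ar t} {f} {g} (s≤s z≤n) (s≤s j<n) })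
  toRT-graft leaf (suc (suc x)) t f g p (s≤s ()) d
  toRT-graft (node o l r) x t f g p q d with x ≤? ar l
  ... | yes x≤l = toRT-graft-left o l r x t f g p x≤l d
  ... | no x≰l with rightPosition o l r x (≰⇒> x≰l) q
  ... | x' , refl , p' , q' = toRT-graft-right o l r x' t f g p' q' d

  toRT-graft-left : ∀ o l r x t f g → 1 ≤ x → x ≤ ar l → Isolates (node o l r) f x →
    GraftsAs (node o l r) x t f g
  toRT-graft-left o l r x t f g p x≤l d rewrite graft-left o l r x t x≤l =
    ≅-trans (product-cong o (toRT-graft l x t f g p x≤l isolatesˡ) (≡⇒≅ (toRT-ext r _ fʳ unchangedʳ)))
            (≅-sym (insert-productˡ o (f x) (toRT t g) (toRT l f) (toRT r fʳ) fx∉r (NonEmpty-toRT r fʳ)))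
    where
    n = ar t
    fʳ = λ i → f (ar l + i)
    G = ar (graft l x t)
    isolatesˡ : Isolates l f x
    isolatesˡ i pi qi = d i pi (≤-trans qi (m≤m+n (ar l) (ar r)))
    unchangedʳ : ∀ i → 1 ≤ i → i ≤ ar r → splice x n f g (G + i) ≡ f (ar l + i)
    unchangedʳ i pi qi = ≡-trans (splice-above {x} {n} {f} {g} bound) (cong f shiftBack)
      where
      bound : x + n ≤ G + i
      bound = ≤-trans (+-monoˡ-≤ n x≤l) (≤-trans (≤-reflexive (sym (ar-graft l x t p x≤l))) (m<m+n G pi))
      shiftBack : suc (G + i) ∸ n ≡ ar l + i
      shiftBack = ≡-trans (cong (λ z → z + i ∸ n) (ar-graft l x t p x≤l))
                  (≡-trans (cong (_∸ n) (+-exchange (ar l) i n)) (m+n∸n≡m (ar l + i) n))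
    fx∉r : elem (f x) (flatten (toRT r fʳ)) ≡ false
    fx∉r = elem-toRT r fʳ (f x) λ i pi qi → d (ar l + i) (≤-trans pi (m≤n+m i (ar l))) (+-monoʳ-≤ (ar l) qi)
             (λ e → <-irrefl (sym e) (≤-<-trans x≤l (m<m+n (ar l) pi)))

  toRT-graft-right : ∀ o l r x' t f g → 1 ≤ x' → x' ≤ ar r → Isolates (node o l r) f (ar l + x') →
    GraftsAs (node o l r) (ar l + x') t f g
  toRT-graft-right o l r x' t f g p q d
    rewrite graft-right o l r (ar l + x') t (m<m+n (ar l) p) | m+n∸m≡n (ar l) x' =
    ≅-trans (product-cong o (≡⇒≅ (toRT-ext l _ f unchangedˡ))
                            (≅-trans (≡⇒≅ (toRT-ext (graft r x' t) _ (splice x' n fʳ g) shifted))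
                                     (toRT-graft r x' t fʳ g p q isolatesʳ)))
            (≅-sym (insert-productʳ o (f x) (toRT t g) (toRT l f) (toRT r fʳ) fx∉l (NonEmpty-toRT l f)))
    where
    n = ar t
    fʳ = λ i → f (ar l + i)
    x = ar l + x'
    isolatesʳ : Isolates r fʳ x'
    isolatesʳ i pi qi ne = d (ar l + i) (≤-trans pi (m≤n+m i (ar l))) (+-monoʳ-≤ (ar l) qi)
                             (λ e → ne (+-cancelˡ-≡ (ar l) i x' e))
    unchangedˡ : ∀ i → 1 ≤ i → i ≤ ar l → splice x n f g i ≡ f i
    unchangedˡ i pi qi = splice-below {x} {n} {f} {g} (≤-<-trans qi (m<m+n (ar l) p))
    shifted : ∀ i → 1 ≤ i → i ≤ ar (graft r x' t) → splice x n f g (ar l + i) ≡ splice x' n fʳ g i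
    shifted i pi qi with i <? x'
    ... | yes lt = ≡-trans (splice-below {x} {n} {f} {g} (+-monoʳ-< (ar l) lt))
                           (sym (splice-below {x'} {n} {fʳ} {g} lt))
    ... | no ge with i <? x' + n
    ...   | yes lt = ≡-trans (splice-inside {x} {n} {f} {g} (+-monoʳ-≤ (ar l) (≮⇒≥ ge))
                               (subst (ar l + i <_) (sym (+-assoc (ar l) x' n)) (+-monoʳ-< (ar l) lt)))
                     (≡-trans (cong (λ z → g (suc z)) ([m+n]∸[m+o]≡n∸o (ar l) i x'))
                              (sym (splice-inside {x'} {n} {fʳ} {g} (≮⇒≥ ge) lt)))
    ...   | no ge' = ≡-trans (splice-above {x} {n} {f} {g}
                               (subst (_≤ ar l + i) (sym (+-assoc (ar l) x' n)) (+-monoʳ-≤ (ar l) (≮⇒≥ ge'))))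
                     (≡-trans (cong f shiftBack) (sym (splice-above {x'} {n} {fʳ} {g} (≮⇒≥ ge'))))
      where
      shiftBack : suc (ar l + i) ∸ n ≡ ar l + (suc i ∸ n)
      shiftBack rewrite sym (+-suc (ar l) i) =
        +-∸-assoc (ar l) (≤-trans (m≤n+m n x') (≤-trans (≮⇒≥ ge') (n≤1+n i)))
    fx∉l : elem (f x) (flatten (toRT l f)) ≡ false
    fx∉l = elem-toRT l f (f x) λ i pi qi → d i pi (≤-trans qi (m≤m+n (ar l) (ar r)))
             (λ e → <-irrefl e (≤-<-trans qi (m<m+n (ar l) p)))

relabelAfter-≤ : ∀ x n i → i ≤ x → relabelAfter x n i ≡ i
relabelAfter-≤ x n i p rewrite <ᵇ-false {x} {i} p = refl

relabelAfter-> : ∀ x n i → x < i → relabelAfter x n i ≡ i + n ∸ 1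
relabelAfter-> x n i p rewrite <ᵇ-true p = refl

φ-compose : ∀ s t x → 1 ≤ x → x ≤ ar s → φ (graft s x t) ≅ compose (φ s) x (φ t)
φ-compose s t x p q rewrite weight-toRT t (λ i → i)
  | mapLab-toRT (shiftBy x) t (λ i → i) | mapLab-toRT (relabelAfter x (ar t)) s (λ i → i) =
  subst (λ z → φ (graft s x t) ≅ insert z (toRT t g) (toRT s f)) (relabelAfter-≤ x n x ≤-refl)
        (≅-trans (≡⇒≅ (toRT-ext (graft s x t) _ _ identity)) (toRT-graft s x t f g p q isolates))
  where
  n = ar t
  f = relabelAfter x n
  g = shiftBy x
  isolates : Isolates s f x
  isolates i pi qi i≢x rewrite relabelAfter-≤ x n x ≤-refl with i <? x
  ... | yes i<x rewrite relabelAfter-≤ x n i (<⇒≤ i<x) = i≢x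
  ... | no i≮x = fi≢x (≤∧≢⇒< (≮⇒≥ i≮x) (λ e → i≢x (sym e)))
    where
    fi≢x : x < i → relabelAfter x n i ≢ x
    fi≢x x<i rewrite relabelAfter-> x n i x<i | +-∸-assoc i (ar≥1 t) =
      λ e → <-irrefl (sym e) (≤-trans x<i (m≤m+n i (n ∸ 1)))
  identity : ∀ i → 1 ≤ i → i ≤ ar (graft s x t) → i ≡ splice x n f g i
  identity i pi qi with i <? x
  ... | yes i<x = sym (≡-trans (splice-below {x} {n} {f} {g} i<x) (relabelAfter-≤ x n i (<⇒≤ i<x)))
  ... | no i≮x with i <? x + n
  ...   | yes i<x+n = sym (≡-trans (splice-inside {x} {n} {f} {g} (≮⇒≥ i≮x) i<x+n) (m∸n+n≡m (≮⇒≥ i≮x)))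
  ...   | no i≮x+n = sym (≡-trans (splice-above {x} {n} {f} {g} (≮⇒≥ i≮x+n))
                     (≡-trans (relabelAfter-> x n (suc i ∸ n) x<1+i-n) (cong (_∸ 1) (m∸n+n≡m n≤1+i))))
    where
    n≤1+i : n ≤ suc i
    n≤1+i = ≤-trans (m≤n+m n x) (≤-trans (≮⇒≥ i≮x+n) (n≤1+n i))
    x<1+i-n : x < suc i ∸ n
    x<1+i-n = ≤-trans (≤-reflexive (sym (m+n∸n≡m (suc x) n))) (∸-monoˡ-≤ n (s≤s (≮⇒≥ i≮x+n)))

genOf : Op → RT
genOf prec = gen₂
genOf succ = gen₃
genOf circ = gen₁
genOf odot = gen₄

Gen-genOf : ∀ o → Gen (genOf o)
Gen-genOf prec = g₂
Gen-genOf succ = g₃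
Gen-genOf circ = g₁
Gen-genOf odot = g₄

φ-generator : ∀ o → φ (node o leaf leaf) ≡ genOf o
φ-generator prec = refl
φ-generator succ = refl
φ-generator circ = refl
φ-generator odot = refl

weight-φ : ∀ s → weight (φ s) ≡ ar s
weight-φ s = weight-toRT s (λ i → i)

ar-≅ : ∀ {s t} → φ s ≅ φ t → ar s ≡ ar t
ar-≅ {s} {t} e = ≡-trans (sym (weight-φ s)) (≡-trans (weight-≅ e) (weight-φ t))

-- node o l r = (o ∘₂ r) ∘₁ l, which BWTS contains once l and r are in it.
φ-InBWTS : ∀ s → InBWTS (φ s)
φ-InBWTS leaf = unitT , gUnit , ≅-refl _
φ-InBWTS (node o l r) with φ-InBWTS l | φ-InBWTS r
... | Tl , Gl , el | Tr , Gr , er =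
  compose (compose (genOf o) 2 Tr) 1 Tl ,
  gComp 1 (gComp 2 (Gen-genOf o) Gr (s≤s z≤n) w2) Gl (s≤s z≤n) w1 ,
  ≅-trans (φ-compose (node o leaf r) l 1 (s≤s z≤n) (s≤s z≤n)) (compose-cong 1 right el)
  where
  w2 : 2 ≤ weight (genOf o)
  w2 = ≤-reflexive (sym (≡-trans (cong weight (sym (φ-generator o))) (weight-φ (node o leaf leaf))))
  right : φ (node o leaf r) ≅ compose (genOf o) 2 Tr
  right = ≅-trans (φ-compose (node o leaf leaf) r 2 (s≤s z≤n) (s≤s (s≤s z≤n)))
                  (compose-cong 2 (≡⇒≅ (φ-generator o)) er)
  w1 : 1 ≤ weight (compose (genOf o) 2 Tr)
  w1 = ≤-trans (s≤s z≤n) (≤-reflexive (≡-trans (sym (weight-φ (node o leaf r))) (weight-≅ right)))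

Gen⇒φ-image : ∀ {T} → Gen T → Σ FT (λ s → φ s ≅ T)
Gen⇒φ-image gUnit = leaf , ≅-refl _
Gen⇒φ-image g₁ = node circ leaf leaf , ≅-refl _
Gen⇒φ-image g₂ = node prec leaf leaf , ≅-refl _
Gen⇒φ-image g₃ = node succ leaf leaf , ≅-refl _
Gen⇒φ-image g₄ = node odot leaf leaf , ≅-refl _
Gen⇒φ-image (gComp x G₁ G₂ p q) with Gen⇒φ-image G₁ | Gen⇒φ-image G₂
... | s₁ , e₁ | s₂ , e₂ = graft s₁ x s₂ ,
  ≅-trans (φ-compose s₁ s₂ x p (≤-trans q (≤-reflexive (≡-trans (sym (weight-≅ e₁)) (weight-φ s₁)))))
          (compose-cong x e₁ e₂)

InBWTS⇒φ-image : ∀ T → InBWTS T → Σ FT (λ s → φ s ≅ T)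
InBWTS⇒φ-image T (T' , G , e) with Gen⇒φ-image G
... | s , e' = s , ≅-trans e' (≅-sym e)

φ-Rel : ∀ {s t} → Rel s t → φ s ≅ φ t
φ-Rel r1 = ≅-refl _
φ-Rel r2 = ≅-refl _
φ-Rel r3 = ≅-refl _
φ-Rel r4 = ≅-refl _
φ-Rel r5 = ≅-refl _
φ-Rel r6 = ≅-refl _
φ-Rel r7 = ≅-refl _
φ-Rel r8 = ≅-refl _

φ-resp : ∀ s t → s ~ t → φ s ≅ φ t
φ-resp s t (ax r) = φ-Rel r
φ-resp s t ~refl = ≅-refl _
φ-resp s t (~sym e) = ≅-sym (φ-resp t s e)
φ-resp s t (~trans {t = u} e e') = ≅-trans (φ-resp s u e) (φ-resp u t e')
φ-resp _ _ (~comp {s} {s'} {t} {t'} x p q e e') with φ-resp s s' e | φ-resp t t' e'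
... | es | et = ≅-trans (φ-compose s t x p q)
  (≅-trans (compose-cong x es et) (≅-sym (φ-compose s' t' x p (≤-trans q (≤-reflexive (ar-≅ es))))))

-- Normal forms in GR₄

node-cong : ∀ o {a a' b b'} → a ~ a' → b ~ b' → node o a b ~ node o a' b'
node-cong o ea eb = ~comp 1 (s≤s z≤n) (s≤s z≤n) (~comp 2 (s≤s z≤n) (s≤s (s≤s z≤n)) (~refl {node o leaf leaf}) eb) ea

reassociate : ∀ {p q p' q'} → node p (node q leaf leaf) leaf ~ node p' leaf (node q' leaf leaf) →
  ∀ a b c → node p (node q a b) c ~ node p' a (node q' b c)
reassociate e a b c =
  ~comp 1 (s≤s z≤n) (s≤s z≤n) (~comp 2 (s≤s z≤n) (s≤s (s≤s z≤n)) (~comp 3 (s≤s z≤n) (s≤s (s≤s (s≤s z≤n))) e ~refl) ~refl) ~refl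

-- Oriented from left to right, the relations rewrite exactly the nodes whose left child fails okLeft.
okLeft : Op → FT → Bool
okLeft prec leaf = true
okLeft prec (node odot _ _) = true
okLeft prec (node _ _ _) = false
okLeft circ leaf = true
okLeft circ (node odot _ _) = true
okLeft circ (node _ _ _) = false
okLeft succ (node odot _ _) = false
okLeft succ _ = true
okLeft odot (node odot _ _) = false
okLeft odot _ = true

IsNormal : FT → Set
IsNormal leaf = ⊤
IsNormal (node o l r) = T (okLeft o l) × IsNormal l × IsNormal r

normalNode : Op → FT → FT → FT
normalNode prec (node succ a₁ a₂) b = node succ a₁ (normalNode prec a₂ b)
normalNode prec (node circ a₁ a₂) b = node circ a₁ (normalNode prec a₂ b)
normalNode prec (node prec a₁ a₂) b = node prec a₁ (normalNode odot a₂ b)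
normalNode prec a b = node prec a b
normalNode circ (node circ a₁ a₂) b = node circ a₁ (normalNode circ a₂ b)
normalNode circ (node succ a₁ a₂) b = node succ a₁ (normalNode circ a₂ b)
normalNode circ (node prec a₁ a₂) b = node circ a₁ (normalNode succ a₂ b)
normalNode circ a b = node circ a b
normalNode odot (node odot a₁ a₂) b = node odot a₁ (normalNode odot a₂ b)
normalNode odot a b = node odot a b
normalNode succ (node odot a₁ a₂) b = node succ a₁ (normalNode succ a₂ b)
normalNode succ a b = node succ a b

normalNode-~ : ∀ o a b → node o a b ~ normalNode o a b
normalNode-~ prec (node succ a₁ a₂) b = ~trans (reassociate (ax r1) a₁ a₂ b) (node-cong succ ~refl (normalNode-~ prec a₂ b))
normalNode-~ prec (node circ a₁ a₂) b = ~trans (reassociate (ax r5) a₁ a₂ b) (node-cong circ ~refl (normalNode-~ prec a₂ b))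
normalNode-~ prec (node prec a₁ a₂) b = ~trans (reassociate (ax r7) a₁ a₂ b) (node-cong prec ~refl (normalNode-~ odot a₂ b))
normalNode-~ prec leaf b = ~refl
normalNode-~ prec (node odot a₁ a₂) b = ~refl
normalNode-~ circ (node circ a₁ a₂) b = ~trans (reassociate (ax r2) a₁ a₂ b) (node-cong circ ~refl (normalNode-~ circ a₂ b))
normalNode-~ circ (node succ a₁ a₂) b = ~trans (reassociate (ax r3) a₁ a₂ b) (node-cong succ ~refl (normalNode-~ circ a₂ b))
normalNode-~ circ (node prec a₁ a₂) b = ~trans (reassociate (ax r4) a₁ a₂ b) (node-cong circ ~refl (normalNode-~ succ a₂ b))
normalNode-~ circ leaf b = ~refl
normalNode-~ circ (node odot a₁ a₂) b = ~refl
normalNode-~ odot (node odot a₁ a₂) b = ~trans (reassociate (ax r6) a₁ a₂ b) (node-cong odot ~refl (normalNode-~ odot a₂ b))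
normalNode-~ odot leaf b = ~refl
normalNode-~ odot (node prec a₁ a₂) b = ~refl
normalNode-~ odot (node succ a₁ a₂) b = ~refl
normalNode-~ odot (node circ a₁ a₂) b = ~refl
normalNode-~ succ (node odot a₁ a₂) b = ~trans (reassociate (ax r8) a₁ a₂ b) (node-cong succ ~refl (normalNode-~ succ a₂ b))
normalNode-~ succ leaf b = ~refl
normalNode-~ succ (node prec a₁ a₂) b = ~refl
normalNode-~ succ (node succ a₁ a₂) b = ~refl
normalNode-~ succ (node circ a₁ a₂) b = ~refl

okLeft-prec⇒circ : ∀ a → T (okLeft prec a) → T (okLeft circ a)
okLeft-prec⇒circ leaf ok = ok
okLeft-prec⇒circ (node odot _ _) ok = ok

okLeft-odot⇒succ : ∀ a → T (okLeft odot a) → T (okLeft succ a)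
okLeft-odot⇒succ leaf ok = ok
okLeft-odot⇒succ (node prec _ _) ok = ok
okLeft-odot⇒succ (node succ _ _) ok = ok
okLeft-odot⇒succ (node circ _ _) ok = ok

normalNode-IsNormal : ∀ o a b → IsNormal a → IsNormal b → IsNormal (normalNode o a b)
normalNode-IsNormal prec (node succ a₁ a₂) b (ok , n₁ , n₂) nb = ok , n₁ , normalNode-IsNormal prec a₂ b n₂ nb
normalNode-IsNormal prec (node circ a₁ a₂) b (ok , n₁ , n₂) nb = ok , n₁ , normalNode-IsNormal prec a₂ b n₂ nb
normalNode-IsNormal prec (node prec a₁ a₂) b (ok , n₁ , n₂) nb = ok , n₁ , normalNode-IsNormal odot a₂ b n₂ nb
normalNode-IsNormal prec leaf b na nb = tt , tt , nb
normalNode-IsNormal prec (node odot a₁ a₂) b na nb = tt , na , nb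
normalNode-IsNormal circ (node circ a₁ a₂) b (ok , n₁ , n₂) nb = ok , n₁ , normalNode-IsNormal circ a₂ b n₂ nb
normalNode-IsNormal circ (node succ a₁ a₂) b (ok , n₁ , n₂) nb = ok , n₁ , normalNode-IsNormal circ a₂ b n₂ nb
normalNode-IsNormal circ (node prec a₁ a₂) b (ok , n₁ , n₂) nb =
  okLeft-prec⇒circ a₁ ok , n₁ , normalNode-IsNormal succ a₂ b n₂ nb
normalNode-IsNormal circ leaf b na nb = tt , tt , nb
normalNode-IsNormal circ (node odot a₁ a₂) b na nb = tt , na , nb
normalNode-IsNormal odot (node odot a₁ a₂) b (ok , n₁ , n₂) nb = ok , n₁ , normalNode-IsNormal odot a₂ b n₂ nb
normalNode-IsNormal odot leaf b na nb = tt , tt , nb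
normalNode-IsNormal odot (node prec a₁ a₂) b na nb = tt , na , nb
normalNode-IsNormal odot (node succ a₁ a₂) b na nb = tt , na , nb
normalNode-IsNormal odot (node circ a₁ a₂) b na nb = tt , na , nb
normalNode-IsNormal succ (node odot a₁ a₂) b (ok , n₁ , n₂) nb =
  okLeft-odot⇒succ a₁ ok , n₁ , normalNode-IsNormal succ a₂ b n₂ nb
normalNode-IsNormal succ leaf b na nb = tt , tt , nb
normalNode-IsNormal succ (node prec a₁ a₂) b na nb = tt , na , nb
normalNode-IsNormal succ (node succ a₁ a₂) b na nb = tt , na , nb
normalNode-IsNormal succ (node circ a₁ a₂) b na nb = tt , na , nb

normalForm : FT → FT
normalForm leaf = leaf
normalForm (node o l r) = normalNode o (normalForm l) (normalForm r)

normalForm-~ : ∀ s → s ~ normalForm s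
normalForm-~ leaf = ~refl
normalForm-~ (node o l r) =
  ~trans (node-cong o (normalForm-~ l) (normalForm-~ r)) (normalNode-~ o (normalForm l) (normalForm r))

normalForm-IsNormal : ∀ s → IsNormal (normalForm s)
normalForm-IsNormal leaf = tt
normalForm-IsNormal (node o l r) =
  normalNode-IsNormal o (normalForm l) (normalForm r) (normalForm-IsNormal l) (normalForm-IsNormal r)

-- Decoding a red and white tree

consRest : RT → Maybe (RT × List RT) → Maybe (RT × List RT)
consRest c nothing = nothing
consRest c (just (d , R)) = just (d , c ∷ R)

pick : ℕ → List RT → Maybe (RT × List RT)
pick m [] = nothing
pick m (c ∷ cs) = if elem m (flatten c) then just (c , cs) else consRest c (pick m cs)

nodeOf : List RT → RT
nodeOf [] = nd [] []
nodeOf (c ∷ []) = c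
nodeOf (c ∷ d ∷ R) = nd [] (c ∷ d ∷ R)

remainder : List ℕ → List RT → RT
remainder L R = if null L then nodeOf R else nd L R

isUnlabelledWhite : List ℕ → List RT → Bool
isUnlabelledWhite L R = null L ∧ allWhite R

-- opFor b c is the operation whose left operand enters asRoot iff b and whose right operand enters asChild iff c.
opFor : Bool → Bool → Op
opFor true true = prec
opFor true false = circ
opFor false true = odot
opFor false false = succ

-- decode n m T is the preimage of T, whose smallest label is m, with fuel n ≥ the weight of T.
mutual
  decode : ℕ → ℕ → RT → FT
  decode zero m T = leaf
  decode (suc n) m (nd L cs) = if elem m L then decodeAtRoot n m (removeN m L) cs else decodeAtChild n m L (pick m cs)

  decodeAtRoot : ℕ → ℕ → List ℕ → List RT → FT
  decodeAtRoot n m L cs =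
    if null L ∧ null cs then leaf
    else node (opFor true (isUnlabelledWhite L cs)) leaf (decode n (suc m) (remainder L cs))

  decodeAtChild : ℕ → ℕ → List ℕ → Maybe (RT × List RT) → FT
  decodeAtChild n m L nothing = leaf
  decodeAtChild n m L (just (c , R)) =
    node (opFor (isRed c) (isUnlabelledWhite L R)) (decode n m c) (decode n (m + weight c) (remainder L R))

occurs : ℕ → RT → ℕ
occurs m c = if elem m (flatten c) then 1 else 0

occurrences : ℕ → List RT → ℕ
occurrences m [] = 0
occurrences m (c ∷ cs) = occurs m c + occurrences m cs

mutual
  Separated : RT → Set
  Separated (nd L cs) = (∀ m → occurrences m cs ≤ 1) × AllSeparated cs

  AllSeparated : List RT → Set
  AllSeparated [] = ⊤
  AllSeparated (c ∷ cs) = Separated c × AllSeparated cs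

occurrences-↭ : ∀ m {cs ds} → cs ↭ ds → occurrences m cs ≡ occurrences m ds
occurrences-↭ m refl = refl
occurrences-↭ m (prep x p) = cong (occurs m x +_) (occurrences-↭ m p)
occurrences-↭ m (swap {xs} {ys} x y p) rewrite occurrences-↭ m p
  | sym (+-assoc (occurs m x) (occurs m y) (occurrences m ys)) | +-comm (occurs m x) (occurs m y) =
  +-assoc (occurs m y) (occurs m x) (occurrences m ys)
occurrences-↭ m (trans p q) = ≡-trans (occurrences-↭ m p) (occurrences-↭ m q)

occurrences-Pointwise : ∀ m {cs es} → Pointwise _≅_ cs es → occurrences m cs ≡ occurrences m es
occurrences-Pointwise m [] = refl
occurrences-Pointwise m (r ∷ P) rewrite elem-↭ m (flatten-≅ r) | occurrences-Pointwise m P = refl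

occurrences-≋ : ∀ m {cs ds} → cs ≋ ds → occurrences m cs ≡ occurrences m ds
occurrences-≋ m (es , P , q) = ≡-trans (occurrences-Pointwise m P) (occurrences-↭ m q)

AllSeparated-↭ : ∀ {cs ds} → cs ↭ ds → AllSeparated cs → AllSeparated ds
AllSeparated-↭ refl i = i
AllSeparated-↭ (prep x p) (a , i) = a , AllSeparated-↭ p i
AllSeparated-↭ (swap x y p) (a , b , i) = b , a , AllSeparated-↭ p i
AllSeparated-↭ (trans p q) i = AllSeparated-↭ q (AllSeparated-↭ p i)

mutual
  Separated-≅ : ∀ {S T} → S ≅ T → Separated S → Separated T
  Separated-≅ (nd≅ p Q@(es , P , q)) (occ , sep) =
    (λ m → subst (_≤ 1) (occurrences-≋ m Q) (occ m)) , AllSeparated-↭ q (AllSeparated-Pointwise P sep)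

  AllSeparated-Pointwise : ∀ {cs es} → Pointwise _≅_ cs es → AllSeparated cs → AllSeparated es
  AllSeparated-Pointwise [] i = i
  AllSeparated-Pointwise (r ∷ P) (a , i) = Separated-≅ r a , AllSeparated-Pointwise P i

data PickRel : Maybe (RT × List RT) → Maybe (RT × List RT) → Set where
  nothing : PickRel nothing nothing
  just : ∀ {c d R R'} → c ≅ d → R ≋ R' → PickRel (just (c , R)) (just (d , R'))

PickRel-refl : ∀ a → PickRel a a
PickRel-refl nothing = nothing
PickRel-refl (just (c , R)) = just (≅-refl c) (≋-refl R)

PickRel-trans : ∀ {a b c} → PickRel a b → PickRel b c → PickRel a c
PickRel-trans nothing nothing = nothing
PickRel-trans (just r Q) (just r' Q') = just (≅-trans r r') (≋-trans Q Q')

PickRel-consRest : ∀ {c e a b} → c ≅ e → PickRel a b → PickRel (consRest c a) (consRest e b)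
PickRel-consRest r nothing = nothing
PickRel-consRest r (just r' Q) = just r' (≋-∷ r Q)

PickRel-swap : ∀ x y {a b} → PickRel a b → PickRel (consRest x (consRest y a)) (consRest y (consRest x b))
PickRel-swap x y nothing = nothing
PickRel-swap x y (just r Q) = just r (≋-trans (≋-∷ (≅-refl x) (≋-∷ (≅-refl y) Q)) (↭⇒≋ (swap x y refl)))

pick-Pointwise : ∀ m {cs es} → Pointwise _≅_ cs es → PickRel (pick m cs) (pick m es)
pick-Pointwise m [] = nothing
pick-Pointwise m {c ∷ _} (r ∷ P) rewrite sym (elem-↭ m (flatten-≅ r)) with elem m (flatten c)
... | true = just r (Pointwise⇒≋ P)
... | false = PickRel-consRest r (pick-Pointwise m P)

-- Without the bound a permutation could change which of two children holding m is picked.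
pick-↭ : ∀ m {cs ds} → cs ↭ ds → occurrences m cs ≤ 1 → PickRel (pick m cs) (pick m ds)
pick-↭ m {cs} refl b = PickRel-refl (pick m cs)
pick-↭ m (prep x p) b with elem m (flatten x)
... | true = just (≅-refl x) (↭⇒≋ p)
... | false = PickRel-consRest (≅-refl x) (pick-↭ m p b)
pick-↭ m (swap x y p) b with elem m (flatten x) | elem m (flatten y)
... | true | true = ⊥-elim (n≮0 (≤-pred b))
... | true | false = just (≅-refl x) (↭⇒≋ (prep y p))
... | false | true = just (≅-refl y) (↭⇒≋ (prep x p))
... | false | false = PickRel-swap x y (pick-↭ m p b)
pick-↭ m (trans p q) b = PickRel-trans (pick-↭ m p b) (pick-↭ m q (subst (_≤ 1) (occurrences-↭ m p) b))

pick-≋ : ∀ m {cs ds} → occurrences m cs ≤ 1 → cs ≋ ds → PickRel (pick m cs) (pick m ds)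
pick-≋ m b (es , P , q) =
  PickRel-trans (pick-Pointwise m P) (pick-↭ m q (subst (_≤ 1) (occurrences-Pointwise m P) b))

pick-just : ∀ m cs {c R} → pick m cs ≡ just (c , R) →
  (AllSeparated cs → Separated c × AllSeparated R) × (∀ m' → occurrences m' R ≤ occurrences m' cs)
pick-just m (c₀ ∷ cs) e with elem m (flatten c₀) | pick m cs in e'
pick-just m (c₀ ∷ cs) refl | true | _ = (λ s → s) , (λ m' → m≤n+m (occurrences m' cs) (occurs m' c₀))
pick-just m (c₀ ∷ cs) refl | false | just (d , R₀) with pick-just m cs e'
... | sep , occ = (λ { (s₀ , s) → proj₁ (sep s) , s₀ , proj₂ (sep s) }) ,
                  (λ m' → +-monoʳ-≤ (occurs m' c₀) (occ m'))

Separated-remainder : ∀ L R → (∀ m → occurrences m R ≤ 1) → AllSeparated R → Separated (remainder L R)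
Separated-remainder [] [] b s = b , s
Separated-remainder [] (c ∷ []) b s = proj₁ s
Separated-remainder [] (c ∷ d ∷ R) b s = b , s
Separated-remainder (y ∷ L) R b s = b , s

null-↭ : ∀ {A : Set} {L L' : List A} → L ↭ L' → null L ≡ null L'
null-↭ {L = []} p rewrite []↭⇒≡[] p = refl
null-↭ {L = y ∷ L} p with ∷↭⇒∷ p
... | _ , _ , refl = refl

null-≋ : ∀ {R R'} → R ≋ R' → null R ≡ null R'
null-≋ (_ , [] , q) = null-↭ q
null-≋ (_ , _ ∷ _ , q) = null-↭ q

isUnlabelledWhite-cong : ∀ {L L' R R'} → L ↭ L' → R ≋ R' → isUnlabelledWhite L R ≡ isUnlabelledWhite L' R'
isUnlabelledWhite-cong p Q rewrite null-↭ p | allWhite-≋ Q = refl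

nodeOf-cong : ∀ {R R'} → R ≋ R' → nodeOf R ≅ nodeOf R'
nodeOf-cong {[]} ([] , [] , q) rewrite []↭⇒≡[] q = ≅-refl _
nodeOf-cong {c ∷ []} (_ ∷ [] , r ∷ [] , q) rewrite ↭-singleton-inv (↭-sym q) = r
nodeOf-cong {c ∷ d ∷ R} {[]} (_ ∷ _ ∷ _ , _ ∷ _ ∷ _ , q) with ↭-length q
... | ()
nodeOf-cong {c ∷ d ∷ R} {_ ∷ []} (_ ∷ _ ∷ _ , _ ∷ _ ∷ _ , q) with ↭-length q
... | ()
nodeOf-cong {c ∷ d ∷ R} {_ ∷ _ ∷ _} Q = nd≅ refl Q

remainder-cong : ∀ {L L' R R'} → L ↭ L' → R ≋ R' → remainder L R ≅ remainder L' R'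
remainder-cong {[]} p Q rewrite []↭⇒≡[] p = nodeOf-cong Q
remainder-cong {y ∷ L} p Q with ∷↭⇒∷ p
... | _ , _ , refl = nd≅ p Q

DecodeInvariant : ℕ → Set
DecodeInvariant n = ∀ m T T' → Separated T → T ≅ T' → decode n m T ≡ decode n m T'

decodeAtChild-cong : ∀ n m {L L' cs ds} → DecodeInvariant n → L ↭ L' →
  (∀ m' → occurrences m' cs ≤ 1) → AllSeparated cs → cs ≋ ds →
  decodeAtChild n m L (pick m cs) ≡ decodeAtChild n m L' (pick m ds)
decodeAtChild-cong n m {L} {L'} {cs} {ds} IH p occ sep Q
  with pick m cs in e | pick m ds | pick-≋ m (occ m) Q
... | nothing | nothing | nothing = refl
... | just (c , R) | just (d , R') | just rc rR with pick-just m cs e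
... | sepPick , occPick rewrite isRed-≅ rc | isUnlabelledWhite-cong p rR | weight-≅ rc =
  cong₂ (node (opFor (isRed d) (isUnlabelledWhite L' R')))
    (IH m c d (proj₁ (sepPick sep)) rc)
    (IH (m + weight d) (remainder L R) (remainder L' R')
        (Separated-remainder L R (λ m' → ≤-trans (occPick m') (occ m')) (proj₂ (sepPick sep)))
        (remainder-cong p rR))

decodeAtRoot-cong : ∀ n m {L L' cs ds} → DecodeInvariant n → L ↭ L' →
  (∀ m' → occurrences m' cs ≤ 1) → AllSeparated cs → cs ≋ ds →
  decodeAtRoot n m L cs ≡ decodeAtRoot n m L' ds
decodeAtRoot-cong n m {L} {L'} {cs} {ds} IH p occ sep Q
  rewrite IH (suc m) (remainder L cs) (remainder L' ds) (Separated-remainder L cs occ sep) (remainder-cong p Q)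
  | null-↭ p | null-≋ Q | allWhite-≋ Q = refl

decode-cong : ∀ n → DecodeInvariant n
decode-cong zero m T T' s r = refl
decode-cong (suc n) m (nd L cs) (nd L' ds) (occ , sep) (nd≅ p Q) rewrite sym (elem-↭ m p) with elem m L
... | true = decodeAtRoot-cong n m (decode-cong n) (removeN-↭ m p) occ sep Q
... | false = decodeAtChild-cong n m (decode-cong n) p occ sep Q

-- Decoding inverts toRT on normal forms

isOdotNode : FT → Bool
isOdotNode (node odot _ _) = true
isOdotNode _ = false

isRed-notAllWhite : ∀ L K → allWhite K ≡ false → isRed (nd L K) ≡ false
isRed-notAllWhite [] K e = e
isRed-notAllWhite (y ∷ L) K e = refl

isRed-labelled : ∀ W y U K → isRed (nd (W ++ y ∷ U) K) ≡ false
isRed-labelled [] y U K = refl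
isRed-labelled (w ∷ W) y U K = refl

allWhite-asChild : ∀ X → allWhite (subtrees asChild X) ≡ true
allWhite-asChild (nd (y ∷ L) cs) = refl
allWhite-asChild (nd [] cs) with allWhite cs in e
... | true = e
... | false = cong (λ b → not b ∧ true) e

isRed-fusedˡ : ∀ X Y Z → isRed (nd (rootLabels asRoot X ++ Y) (subtrees asRoot X ++ Z)) ≡ false
isRed-fusedˡ (nd (y ∷ L) cs) Y Z = refl
isRed-fusedˡ (nd [] cs) Y Z with allWhite cs in e
... | true = isRed-notAllWhite Y (nd [] cs ∷ Z) (cong (λ b → not b ∧ allWhite Z) e)
... | false = isRed-notAllWhite Y (cs ++ Z) (≡-trans (allWhite-++ cs Z) (cong (_∧ allWhite Z) e))

isRed-fusedʳ : ∀ W V X → isRed (nd (W ++ rootLabels asRoot X) (V ++ subtrees asRoot X)) ≡ false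
isRed-fusedʳ W V (nd (y ∷ L) cs) = isRed-labelled W y L _
isRed-fusedʳ W V (nd [] cs) with allWhite cs in e
... | true = isRed-notAllWhite (W ++ []) (V ++ nd [] cs ∷ [])
  (≡-trans (allWhite-++ V _) (≡-trans (cong (λ b → allWhite V ∧ (not b ∧ true)) e) (∧-zeroʳ (allWhite V))))
... | false = isRed-notAllWhite (W ++ []) (V ++ cs)
  (≡-trans (allWhite-++ V cs) (≡-trans (cong (allWhite V ∧_) e) (∧-zeroʳ (allWhite V))))

isRed-toRT : ∀ s f → isRed (toRT s f) ≡ isOdotNode s
isRed-toRT leaf f = refl
isRed-toRT (node odot l r) f rewrite allWhite-++ (subtrees asChild (toRT l f)) (subtrees asChild (toRT r (λ i → f (ar l + i))))
  | allWhite-asChild (toRT l f) | allWhite-asChild (toRT r (λ i → f (ar l + i))) = refl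
isRed-toRT (node prec l r) f = isRed-fusedˡ (toRT l f) _ _
isRed-toRT (node circ l r) f = isRed-fusedˡ (toRT l f) _ _
isRed-toRT (node succ l r) f = isRed-fusedʳ [] _ (toRT r (λ i → f (ar l + i)))

AtLeastTwo : List RT → Set
AtLeastTwo (_ ∷ _ ∷ _) = ⊤
AtLeastTwo _ = ⊥

Reduced : RT → Set
Reduced T = null (labels T) ≡ true → AtLeastTwo (children T)

null-subtrees : ∀ m X → Reduced X → null (rootLabels m X) ≡ true → null (subtrees m X) ≡ false
null-subtrees asChild (nd (y ∷ L) cs) t e = refl
null-subtrees asChild (nd [] cs) t e with allWhite cs | t refl
... | true | _ with cs
...   | _ ∷ _ ∷ _ = refl
null-subtrees asChild (nd [] cs) t e | false | _ = refl
null-subtrees asRoot (nd [] cs) t e with allWhite cs | t refl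
... | true | _ = refl
... | false | _ with cs
...   | _ ∷ _ ∷ _ = refl

null-++ : ∀ {A : Set} (xs ys : List A) → null (xs ++ ys) ≡ null xs ∧ null ys
null-++ [] ys = refl
null-++ (x ∷ xs) ys = refl

AtLeastTwo-++ : ∀ (xs ys : List RT) → null xs ≡ false → null ys ≡ false → AtLeastTwo (xs ++ ys)
AtLeastTwo-++ (x ∷ []) (y ∷ ys) _ _ = tt
AtLeastTwo-++ (x ∷ x' ∷ xs) ys _ _ = tt

∧-true : ∀ {a b} → a ∧ b ≡ true → a ≡ true × b ≡ true
∧-true {true} {true} e = refl , refl

Reduced-toRT : ∀ s f → Reduced (toRT s f)
Reduced-toRT leaf f ()
Reduced-toRT (node o l r) f e
  with ∧-true (≡-trans (sym (null-++ (rootLabels (leftMode o) (toRT l f)) (rootLabels (rightMode o) (toRT r _)))) e)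
... | el , er = AtLeastTwo-++ (subtrees (leftMode o) (toRT l f)) (subtrees (rightMode o) (toRT r _))
                  (null-subtrees (leftMode o) (toRT l f) (Reduced-toRT l f) el)
                  (null-subtrees (rightMode o) (toRT r _) (Reduced-toRT r _) er)

nodeOf-AtLeastTwo : ∀ cs → AtLeastTwo cs → nodeOf cs ≡ nd [] cs
nodeOf-AtLeastTwo (_ ∷ _ ∷ _) _ = refl

remainder-mode : ∀ m X → Reduced X → remainder (rootLabels m X) (subtrees m X) ≡ X
remainder-mode asChild (nd (y ∷ L) cs) t = refl
remainder-mode asChild (nd [] cs) t with allWhite cs
... | true = nodeOf-AtLeastTwo cs (t refl)
... | false = refl
remainder-mode asRoot (nd (y ∷ L) cs) t = refl
remainder-mode asRoot (nd [] cs) t with allWhite cs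
... | true = refl
... | false = nodeOf-AtLeastTwo cs (t refl)

isAsChild : Mode → Bool
isAsChild asChild = true
isAsChild asRoot = false

isUnlabelledWhite-mode : ∀ m X → isUnlabelledWhite (rootLabels m X) (subtrees m X) ≡ isAsChild m
isUnlabelledWhite-mode asChild X = allWhite-asChild X
isUnlabelledWhite-mode asRoot (nd (y ∷ L) cs) = refl
isUnlabelledWhite-mode asRoot (nd [] cs) with allWhite cs in e
... | true = cong (λ b → not b ∧ true) e
... | false = e

NonEmptyNode⇒¬null : ∀ L K → NonEmptyNode L K → null L ∧ null K ≡ false
NonEmptyNode⇒¬null (y ∷ L) K n = refl
NonEmptyNode⇒¬null [] (k ∷ K) n = refl

decode-leafFirst : ∀ n k m B → NonEmptyNode (rootLabels m B) (subtrees m B) → Reduced B →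
  elem (suc k) (flatten B) ≡ false →
  decode (suc n) (suc k) (nd (rootLabels asRoot (nd (suc k ∷ []) []) ++ rootLabels m B)
                             (subtrees asRoot (nd (suc k ∷ []) []) ++ subtrees m B))
  ≡ node (opFor true (isAsChild m)) leaf (decode n (suc (suc k)) B)
decode-leafFirst n k m B ne red k∉B
  rewrite ≡ᵇ-refl k | removeN-∉ (suc k) (rootLabels m B) (proj₁ (elem-mode m B (suc k) k∉B))
  | NonEmptyNode⇒¬null (rootLabels m B) (subtrees m B) ne | isUnlabelledWhite-mode m B | remainder-mode m B red = refl

decode-treeFirst : ∀ n k mˡ mʳ A B → rootLabels mˡ A ≡ [] → subtrees mˡ A ≡ A ∷ [] →
  elem (suc k) (flatten A) ≡ true → elem (suc k) (rootLabels mʳ B) ≡ false → Reduced B →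
  decode (suc n) (suc k) (nd (rootLabels mˡ A ++ rootLabels mʳ B) (subtrees mˡ A ++ subtrees mʳ B))
  ≡ node (opFor (isRed A) (isAsChild mʳ)) (decode n (suc k) A) (decode n (suc k + weight A) B)
decode-treeFirst n k mˡ mʳ A B eL eK k∈A k∉B red
  rewrite eL | eK | k∉B | k∈A | isUnlabelledWhite-mode mʳ B | remainder-mode mʳ B red = refl

leafLabels-head : ∀ s f → ∃ λ xs → leafLabels s f ≡ f 1 ∷ xs
leafLabels-head leaf f = [] , refl
leafLabels-head (node o l r) f with leafLabels-head l f
... | xs , e rewrite e = _ , refl

elem-first : ∀ s k → elem (suc k) (flatten (toRT s (k +_))) ≡ true
elem-first s k with leafLabels-head s (k +_)
... | xs , e rewrite elem-↭ (suc k) (flatten-toRT s (k +_)) | e | +-comm k 1 | ≡ᵇ-refl k = refl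

elem-beyond : ∀ s j k → 1 ≤ j → elem (suc k) (flatten (toRT s ((k + j) +_))) ≡ false
elem-beyond s j k j≥1 =
  elem-toRT s _ (suc k) λ i i≥1 _ e → <-irrefl (sym e) (≤-<-trans (m<m+n k j≥1) (m<m+n (k + j) i≥1))

toRT-offset : ∀ k l r → toRT r (λ i → k + (ar l + i)) ≡ toRT r ((k + ar l) +_)
toRT-offset k l r = toRT-ext r _ _ (λ i _ _ → sym (+-assoc k (ar l) i))

decode-node-treeFirst : ∀ n k o l r →
  rootLabels (leftMode o) (toRT l (k +_)) ≡ [] → subtrees (leftMode o) (toRT l (k +_)) ≡ toRT l (k +_) ∷ [] →
  opFor (isOdotNode l) (isAsChild (rightMode o)) ≡ o →
  decode n (suc k) (toRT l (k +_)) ≡ l → decode n (suc (k + ar l)) (toRT r ((k + ar l) +_)) ≡ r →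
  decode (suc n) (suc k) (toRT (node o l r) (k +_)) ≡ node o l r
decode-node-treeFirst n k o l r eL eK eo hl hr rewrite toRT-offset k l r
  | decode-treeFirst n k (leftMode o) (rightMode o) (toRT l (k +_)) (toRT r ((k + ar l) +_)) eL eK (elem-first l k)
      (proj₁ (elem-mode (rightMode o) (toRT r ((k + ar l) +_)) (suc k) (elem-beyond r (ar l) k (ar≥1 l))))
      (Reduced-toRT r _)
  | isRed-toRT l (k +_) | weight-toRT l (k +_) | hl | hr | eo = refl

decode-node-leafFirst : ∀ n k o r → leftMode o ≡ asRoot → opFor true (isAsChild (rightMode o)) ≡ o →
  decode n (suc (suc k)) (toRT r (suc k +_)) ≡ r →
  decode (suc n) (suc k) (toRT (node o leaf r) (k +_)) ≡ node o leaf r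
decode-node-leafFirst n k o r em eo hr rewrite toRT-offset k leaf r | +-comm k 1 | em
  | decode-leafFirst n k (rightMode o) (toRT r (suc k +_)) (NonEmpty-mode (rightMode o) _ (NonEmpty-toRT r _))
      (Reduced-toRT r _) (subst (λ z → elem (suc k) (flatten (toRT r (z +_))) ≡ false) (+-comm k 1) (elem-beyond r 1 k (s≤s z≤n)))
  | hr | eo = refl

-- The modes in which an operand of the given colour enters as a single child of the root.
EntersAsChild : Mode → Bool → Set
EntersAsChild asRoot true = ⊤
EntersAsChild asChild false = ⊤
EntersAsChild _ _ = ⊥

single-subtree : ∀ m T → EntersAsChild m (isRed T) → rootLabels m T ≡ [] × subtrees m T ≡ T ∷ []
single-subtree asRoot T e with isRed T
... | true = refl , refl
single-subtree asChild T e with isRed T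
... | false = refl , refl

opFor-leafFirst : ∀ o → leftMode o ≡ asRoot → opFor true (isAsChild (rightMode o)) ≡ o
opFor-leafFirst prec _ = refl
opFor-leafFirst circ _ = refl

opFor-treeFirst : ∀ o b → EntersAsChild (leftMode o) b → opFor b (isAsChild (rightMode o)) ≡ o
opFor-treeFirst prec true _ = refl
opFor-treeFirst circ true _ = refl
opFor-treeFirst succ false _ = refl
opFor-treeFirst odot false _ = refl

data NormalLeft (o : Op) : FT → Set where
  leafLeft : leftMode o ≡ asRoot → NormalLeft o leaf
  treeLeft : ∀ {l} → EntersAsChild (leftMode o) (isOdotNode l) → NormalLeft o l

normalLeft : ∀ o l → T (okLeft o l) → NormalLeft o l
normalLeft prec leaf _ = leafLeft refl
normalLeft prec (node odot _ _) _ = treeLeft tt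
normalLeft circ leaf _ = leafLeft refl
normalLeft circ (node odot _ _) _ = treeLeft tt
normalLeft succ leaf _ = treeLeft tt
normalLeft succ (node prec _ _) _ = treeLeft tt
normalLeft succ (node succ _ _) _ = treeLeft tt
normalLeft succ (node circ _ _) _ = treeLeft tt
normalLeft odot leaf _ = treeLeft tt
normalLeft odot (node prec _ _) _ = treeLeft tt
normalLeft odot (node succ _ _) _ = treeLeft tt
normalLeft odot (node circ _ _) _ = treeLeft tt

ar-operands≤ : ∀ o l r n → ar (node o l r) ≤ suc n → ar l ≤ n × ar r ≤ n
ar-operands≤ o l r n le =
  +-cancelˡ-≤ 1 (ar l) n (≤-trans (≤-reflexive (+-comm 1 (ar l))) (≤-trans (+-monoʳ-≤ (ar l) (ar≥1 r)) le)) ,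
  +-cancelˡ-≤ 1 (ar r) n (≤-trans (+-monoˡ-≤ (ar r) (ar≥1 l)) le)

decode-toRT : ∀ n s k → IsNormal s → ar s ≤ n → decode n (suc k) (toRT s (k +_)) ≡ s
decode-toRT zero s k _ le with ≤-trans (ar≥1 s) le
... | ()
decode-toRT (suc n) leaf k _ _ rewrite +-comm k 1 | ≡ᵇ-refl k = refl
decode-toRT (suc n) (node o l r) k (ok , nl , nr) le with ar-operands≤ o l r n le | normalLeft o l ok
... | _ , ar-r≤n | leafLeft em =
  decode-node-leafFirst n k o r em (opFor-leafFirst o em) (decode-toRT n r (suc k) nr ar-r≤n)
... | ar-l≤n , ar-r≤n | treeLeft e with single-subtree (leftMode o) (toRT l (k +_))
                                             (subst (EntersAsChild (leftMode o)) (sym (isRed-toRT l (k +_))) e)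
... | eL , eK = decode-node-treeFirst n k o l r eL eK (opFor-treeFirst o (isOdotNode l) e)
                  (decode-toRT n l k nl ar-l≤n) (decode-toRT n r (k + ar l) nr ar-r≤n)

occurrences-++ : ∀ m xs ys → occurrences m (xs ++ ys) ≡ occurrences m xs + occurrences m ys
occurrences-++ m [] ys = refl
occurrences-++ m (x ∷ xs) ys rewrite occurrences-++ m xs ys = sym (+-assoc (occurs m x) (occurrences m xs) (occurrences m ys))

occurrences-∉ : ∀ m xs → elem m (flattenL xs) ≡ false → occurrences m xs ≡ 0
occurrences-∉ m [] e = refl
occurrences-∉ m (x ∷ xs) e with elem-++-false m (flatten x) (flattenL xs) e
... | ex , exs rewrite ex = occurrences-∉ m xs exs

occurrences-singleton : ∀ m x → occurrences m (x ∷ []) ≤ 1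
occurrences-singleton m x with elem m (flatten x)
... | true = s≤s z≤n
... | false = z≤n

AllSeparated-++ : ∀ xs ys → AllSeparated xs → AllSeparated ys → AllSeparated (xs ++ ys)
AllSeparated-++ [] ys _ s = s
AllSeparated-++ (x ∷ xs) ys (s₀ , s) s' = s₀ , AllSeparated-++ xs ys s s'

SeparatedChildren : List RT → Set
SeparatedChildren cs = (∀ m → occurrences m cs ≤ 1) × AllSeparated cs

separated-subtrees : ∀ md X → Separated X → SeparatedChildren (subtrees md X)
separated-subtrees asChild X@(nd L cs) s with isRed X
... | true = s
... | false = (λ m → occurrences-singleton m X) , s , tt
separated-subtrees asRoot X@(nd L cs) s with isRed X
... | true = (λ m → occurrences-singleton m X) , s , tt
... | false = s

Separated-product : ∀ o A B → Separated A → Separated B →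
  (∀ m → elem m (flatten A) ≡ false ⊎ elem m (flatten B) ≡ false) → Separated (product o A B)
Separated-product o A B sA sB disjoint = atMostOnce , AllSeparated-++ _ _ (proj₂ sepA) (proj₂ sepB)
  where
  sepA = separated-subtrees (leftMode o) A sA
  sepB = separated-subtrees (rightMode o) B sB
  atMostOnce : ∀ m → occurrences m (subtrees (leftMode o) A ++ subtrees (rightMode o) B) ≤ 1
  atMostOnce m rewrite occurrences-++ m (subtrees (leftMode o) A) (subtrees (rightMode o) B) with disjoint m
  ... | inj₁ m∉A rewrite occurrences-∉ m (subtrees (leftMode o) A) (proj₂ (elem-mode (leftMode o) A m m∉A)) =
    proj₁ sepB m
  ... | inj₂ m∉B rewrite occurrences-∉ m (subtrees (rightMode o) B) (proj₂ (elem-mode (rightMode o) B m m∉B))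
        | +-identityʳ (occurrences m (subtrees (leftMode o) A)) = proj₁ sepA m

Separated-toRT : ∀ s k → Separated (toRT s (k +_))
Separated-toRT leaf k = (λ m → z≤n) , tt
Separated-toRT (node o l r) k rewrite toRT-offset k l r =
  Separated-product o (toRT l (k +_)) (toRT r ((k + ar l) +_)) (Separated-toRT l k) (Separated-toRT r (k + ar l)) disjoint
  where
  disjoint : ∀ m → elem m (flatten (toRT l (k +_))) ≡ false ⊎ elem m (flatten (toRT r ((k + ar l) +_))) ≡ false
  disjoint m with m ≤? k + ar l
  ... | yes m≤ = inj₂ (elem-toRT r _ m λ i i≥1 _ e → <-irrefl (sym e) (≤-<-trans m≤ (m<m+n (k + ar l) i≥1)))
  ... | no m≰ = inj₁ (elem-toRT l _ m λ i _ i≤ e → <-irrefl e (≤-<-trans {k + i} (+-monoʳ-≤ k i≤) (≰⇒> m≰)))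

φ-injective : ∀ s t → φ s ≅ φ t → s ~ t
φ-injective s t e = ~trans (normalForm-~ s) (subst (_~ t) (sym s*≡t*) (~sym (normalForm-~ t)))
  where
  s* = normalForm s
  t* = normalForm t
  e* : φ s* ≅ φ t*
  e* = ≅-trans (φ-resp s* s (~sym (normalForm-~ s))) (≅-trans e (φ-resp t t* (normalForm-~ t)))
  s*≡t* : s* ≡ t*
  s*≡t* = ≡-trans (sym (decode-toRT (ar s*) s* 0 (normalForm-IsNormal s) ≤-refl))
            (≡-trans (decode-cong (ar s*) 1 (φ s*) (φ t*) (Separated-toRT s* 0) e*)
                     (decode-toRT (ar s*) t* 0 (normalForm-IsNormal t) (≤-reflexive (sym (ar-≅ e*)))))

mainTheorem7 : Σ (FT → RT) IsOperadIso
mainTheorem7 = φ , record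
  { arity = weight-φ
  ; into = φ-InBWTS
  ; onto = InBWTS⇒φ-image
  ; resp = φ-resp
  ; injec = φ-injective
  ; unit = ≅-refl _
  ; compat = φ-compose
  }
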